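{- Let $n$ be a positive integer. For each permutation $\sigma\in\mathfrak S_n$: (1) there exists exactly one way to decorate letters of $\sigma$ so that the resulting decorated permutation is a Dyck alternating dinv representative; (2) there exists exactly one way to decorate letters of $\sigma$ so that the resulting decorated permutation is an alternating dinv representative whose number of undecorated letters is odd.
   Context: A decorated permutation is a permutation of $[n]$ some of whose letters are marked as decorated; its underlying permutation forgets the marks. Write $\sigma=\rho_0\rho_1\cdots\rho_l$ as its maximal decreasing runs and let $\tilde\rho_i$ be the set of undecorated letters of $\rho_i$ ($\rho_{l+1}=\emptyset$). For a shift $s\in\{0,\dots,l\}$ the run $\rho_i$ is negative, zero, or positive according as $i<s$, $i=s$, $i>s$. The schedule number of $c\in\rho_i$ is: $w_{\sigma,s}(c)=\#\{d\in\tilde\rho_i:d>c\}+1$ if $i=s$ and $c$ undecorated; $\#\{d\in\tilde\rho_i:d>c\}+\#\{d\in\tilde\rho_{i-1}:d<c\}$ if $i>s$ and $c$ undecorated; $\#\{d\in\tilde\rho_i:d<c\}+\#\{d\in\tilde\rho_{i+1}:d>c\}$ if $i<s$ or $c$ decorated; for $s>l$ all schedule numbers are $0$. A decorated permutation is an alternating dinv representative (ADR) if for some shift $s$ all its schedule numbers $w_{\sigma,s}(c)$ equal $1$, and a Dyck alternating dinv representative if this holds with $s=0$. -}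

module Defs where

open import Data.Bool using (Bool; true; false; not; if_then_else_)
open import Data.Nat using (ℕ; zero; suc; _+_; _∸_; _<_; _≤_; _<ᵇ_; _≡ᵇ_; _%_)
open import Data.List using (List; []; _∷_; length; filterᵇ; map; concat; zip; upTo)
open import Data.List.Relation.Unary.All using (All)
open import Data.Product using (_×_; _,_; Σ; ∃; proj₁; proj₂)
open import Data.Fin using (Fin; toℕ)
open import Data.Fin.Permutation using (Permutation′; _⟨$⟩ʳ_)
open import Data.Vec using (Vec; tabulate; lookup; toList)
open import Relation.Binary.PropositionalEquality using (_≡_)

-- A letter of a decorated word: (value, decorated?)
Letter : Set
Letter = ℕ × Bool

-- One-line notation of σ with decoration d (d indexed by positions of σ;
-- d i = true means the letter at position i is decorated).  Letters are
-- toℕ (σ i) ∈ {0,…,n-1}, an order-preserving shift of [n].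
decWord : ∀ {n} → Permutation′ n → Vec Bool n → List Letter
decWord {n} σ d = toList (tabulate λ i → (toℕ (σ ⟨$⟩ʳ i) , lookup d i))

private
  pushRun : Letter → List (List Letter) → List (List Letter)
  pushRun x [] = (x ∷ []) ∷ []
  pushRun x ([] ∷ rs) = (x ∷ []) ∷ rs
  pushRun x ((y ∷ r) ∷ rs) =
    if proj₁ y <ᵇ proj₁ x then (x ∷ y ∷ r) ∷ rs else (x ∷ []) ∷ (y ∷ r) ∷ rs

runs : List Letter → List (List Letter)
runs [] = []
runs (x ∷ xs) = pushRun x (runs xs)

-- i-th run, with the convention that out-of-range runs are empty (ρ_{l+1} = ∅).
runAt : List (List Letter) → ℕ → List Letter
runAt [] _ = []
runAt (r ∷ rs) zero = r
runAt (r ∷ rs) (suc i) = runAt rs i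

undec : List Letter → List ℕ
undec r = map proj₁ (filterᵇ (λ x → not (proj₂ x)) r)

countGt : ℕ → List ℕ → ℕ
countGt c ds = length (filterᵇ (λ d → c <ᵇ d) ds)

countLt : ℕ → List ℕ → ℕ
countLt c ds = length (filterᵇ (λ d → d <ᵇ c) ds)

-- schedule number w_{σ,s}(c) of a letter c = (v, dec) lying in run ρ_i,
-- where rs = (ρ₀,…,ρ_l).
schedule : List (List Letter) → ℕ → ℕ → Letter → ℕ
schedule rs s i (c , dec) =
  if length rs ∸ 1 <ᵇ s then 0
  else if dec then negCase
  else if i <ᵇ s then negCase
  else if i ≡ᵇ s then countGt c (undec (runAt rs i)) + 1
  else countGt c (undec (runAt rs i)) + countLt c (undec (runAt rs (i ∸ 1)))
  where
  negCase : ℕ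
  negCase = countLt c (undec (runAt rs i)) + countGt c (undec (runAt rs (suc i)))

schedules : List (List Letter) → ℕ → List ℕ
schedules rs s =
  concat (map (λ ir → map (schedule rs s (proj₁ ir)) (proj₂ ir))
              (zip (upTo (length rs)) rs))

AllScheduleOne : ∀ {n} → Permutation′ n → Vec Bool n → ℕ → Set
AllScheduleOne σ d s = All (_≡ 1) (schedules (runs (decWord σ d)) s)

numRuns : ∀ {n} → Permutation′ n → Vec Bool n → ℕ
numRuns σ d = length (runs (decWord σ d))

IsADR : ∀ {n} → Permutation′ n → Vec Bool n → Set
IsADR σ d = Σ ℕ λ s → s < numRuns σ d × AllScheduleOne σ d s

IsDyckADR : ∀ {n} → Permutation′ n → Vec Bool n → Set
IsDyckADR σ d = AllScheduleOne σ d 0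

numUndecorated : ∀ {n} → Vec Bool n → ℕ
numUndecorated d = length (filterᵇ not (toList d))

Odd : ℕ → Set
Odd k = k % 2 ≡ 1

-- The schedule conditions are local: writing Uᵢ for the undecorated letters of the run ρᵢ, they only
-- compare ρᵢ with Uᵢ₋₁ and Uᵢ₊₁.  They force Uᵢ = {gᵢ} or Uᵢ = {max ρᵢ, gᵢ}, where the pivot gᵢ is the
-- largest letter of ρᵢ below max Uᵢ₊₁ (the least letter of ρᵢ if Uᵢ₊₁ = ∅), and for i ≥ 1 the previous
-- run decides between the two: Uᵢ = {gᵢ} exactly when ρᵢ₋₁ has a letter below gᵢ.  Going down from the
-- last run, U₁, …, U_l are therefore the same for every alternating dinv representative, whatever its
-- shift; with shift 0 also U₀ = {g₀}, and the same recursion builds the Dyck representative.  With a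
-- shift s > 0 the run ρ₀ is negative and U₀ is ∅, {g₀} or {max ρ₀, g₀}, where ∅ and {max ρ₀, g₀}
-- exclude each other; so the parity of the number of undecorated letters determines U₀.  If the Dyck
-- representative has an even number of undecorated letters, some run j ≥ 1 has |Uⱼ| = 1, and taking j
-- as the zero run lets U₀ be ∅ or {max ρ₀, g₀}, which makes the count odd.

module Submission where

open import Defs
open import Data.Bool using (Bool; true; false; not; T; _∨_; if_then_else_)
open import Data.Empty using (⊥; ⊥-elim)
open import Data.Fin using (Fin; toℕ)
import Data.Fin as Fin
open import Data.Fin.Permutation using (Permutation′; _⟨$⟩ʳ_; _⟨$⟩ˡ_; inverseˡ)
open import Data.Fin.Properties using (toℕ-injective)
open import Data.List using (List; []; _∷_; length; filterᵇ; map; concat; _++_; zip; applyUpTo)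
import Data.List as List
open import Data.List.Membership.Propositional using (_∈_; _∉_)
open import Data.List.Membership.Propositional.Properties using (∈-map⁺; ∈-map⁻; ∈-++⁺ˡ; ∈-++⁺ʳ)
open import Data.List.Properties
  using (∷-injectiveˡ; ∷-injectiveʳ; length-map; length-++; length-tabulate; map-++; concat-map; filter-++)
open import Data.List.Relation.Unary.All as All using (All; []; _∷_)
open import Data.List.Relation.Unary.All.Properties using (++⁺; ++⁻; map⁺; map⁻; All¬⇒¬Any)
open import Data.List.Relation.Unary.AllPairs as AllPairs using (AllPairs; []; _∷_)
open import Data.List.Relation.Unary.Any using (here; there)
open import Data.List.Relation.Unary.Unique.Propositional using (Unique)
open import Data.List.Relation.Unary.Unique.Propositional.Properties using (tabulate⁺)
open import Data.Maybe using (Maybe; just; nothing)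
open import Data.Nat using (ℕ; zero; suc; _+_; _∸_; _≤_; _<_; _>_; _<ᵇ_; _≡ᵇ_; z≤n; s≤s; z<s; _%_)
open import Data.Nat.Properties
open import Data.Product using (Σ; ∃!; _×_; _,_; proj₁; proj₂)
open import Data.Sum using (_⊎_; inj₁; inj₂)
open import Data.Unit using (⊤; tt)
open import Data.Vec using (Vec; toList; lookup)
import Data.Vec as Vec
open import Data.Vec.Properties using (toList-cast; toList∘fromList; toList-injective)
open import Data.Vec.Relation.Binary.Equality.Cast using (cast-is-id)
open import Function using (_∘′_; _⇔_; mk⇔; Equivalence)
open import Relation.Binary.Definitions using (tri<; tri≈; tri>)
open import Relation.Binary.PropositionalEquality using (_≡_; _≢_; refl; sym; trans; cong; cong₂; subst; subst₂)
open import Relation.Nullary using (¬_; yes; no; T?)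

1≤m∧1≤n⇒m+n≢1 : ∀ {m n} → 1 ≤ m → 1 ≤ n → m + n ≢ 1
1≤m∧1≤n⇒m+n≢1 {suc m} {suc n} _ _ e = 1+n≢0 (trans (sym (+-suc m n)) (suc-injective e))

2≤m⇒m+n≢1 : ∀ {m n} → 2 ≤ m → m + n ≢ 1
2≤m⇒m+n≢1 (s≤s (s≤s _)) ()

2≤n⇒m+n≢1 : ∀ {m n} → 2 ≤ n → m + n ≢ 1
2≤n⇒m+n≢1 {m} {n} p e = 2≤m⇒m+n≢1 p (trans (+-comm n m) e)

m≡0∧n≡0⇒m+n≢1 : ∀ {m n} → m ≡ 0 → n ≡ 0 → m + n ≢ 1
m≡0∧n≡0⇒m+n≢1 refl refl ()

n≡0∧m+n≡1⇒m≡1 : ∀ {m n} → n ≡ 0 → m + n ≡ 1 → m ≡ 1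
n≡0∧m+n≡1⇒m≡1 {m} refl e = trans (sym (+-identityʳ m)) e

m≡1∧m+n≡1⇒n≡0 : ∀ {m n} → m ≡ 1 → m + n ≡ 1 → n ≡ 0
m≡1∧m+n≡1⇒n≡0 refl e = suc-injective e

m+1≡1⇒m≡0 : ∀ {m} → m + 1 ≡ 1 → m ≡ 0
m+1≡1⇒m≡0 {m} e = suc-injective (trans (sym (+-comm m 1)) e)

parity : ∀ n → (n % 2 ≡ 1) ⊎ (suc n % 2 ≡ 1)
parity zero = inj₂ refl
parity (suc zero) = inj₁ refl
parity (suc (suc n)) = parity n

parity-flip : ∀ n → n % 2 ≡ 1 → suc n % 2 ≡ 1 → ⊥
parity-flip zero () _
parity-flip (suc zero) _ ()
parity-flip (suc (suc n)) = parity-flip n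

double-even : ∀ m → (m + m) % 2 ≢ 1
double-even zero ()
double-even (suc m) rewrite +-suc m m = double-even m

downward-induction : ∀ (P : ℕ → Set) L → (∀ i → L ≤ i → P i) → (∀ i → i < L → P (suc i) → P i) → ∀ i → P i
downward-induction P L base step i = go L i (m≤n+m L i)
  where
  go : ∀ k i → L ≤ i + k → P i
  go zero i p = base i (subst (L ≤_) (+-identityʳ i) p)
  go (suc k) i p with L ≤? i
  ... | yes q = base i q
  ... | no q = step i (≰⇒> q) (go k (suc i) (subst (L ≤_) (+-suc i k) p))

<ᵇ-true : ∀ {m n} → m < n → (m <ᵇ n) ≡ true
<ᵇ-true {m} {n} p with m <ᵇ n in e
... | true = refl
... | false = ⊥-elim (subst T e (<⇒<ᵇ p))

<ᵇ-false : ∀ {m n} → n ≤ m → (m <ᵇ n) ≡ false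
<ᵇ-false {m} {n} p with m <ᵇ n in e
... | true = ⊥-elim (<⇒≱ (<ᵇ⇒< m n (subst T (sym e) tt)) p)
... | false = refl

<ᵇ-true⁻ : ∀ {m n} → (m <ᵇ n) ≡ true → m < n
<ᵇ-true⁻ {m} {n} e = <ᵇ⇒< m n (subst T (sym e) tt)

<ᵇ-false⁻ : ∀ {m n} → (m <ᵇ n) ≡ false → n ≤ m
<ᵇ-false⁻ e = ≮⇒≥ (λ p → subst T e (<⇒<ᵇ p))

≡ᵇ-refl : ∀ n → (n ≡ᵇ n) ≡ true
≡ᵇ-refl zero = refl
≡ᵇ-refl (suc n) = ≡ᵇ-refl n

≢⇒≡ᵇ-false : ∀ {m n} → m ≢ n → (m ≡ᵇ n) ≡ false
≢⇒≡ᵇ-false {m} {n} ne with m ≡ᵇ n in e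
... | true = ⊥-elim (ne (≡ᵇ⇒≡ m n (subst T (sym e) tt)))
... | false = refl

true≢false : true ≢ false
true≢false ()

countLt-accept : ∀ {c u} us → u < c → countLt c (u ∷ us) ≡ suc (countLt c us)
countLt-accept us p rewrite <ᵇ-true p = refl

countLt-reject : ∀ {c u} us → c ≤ u → countLt c (u ∷ us) ≡ countLt c us
countLt-reject us p rewrite <ᵇ-false p = refl

countGt-accept : ∀ {c u} us → c < u → countGt c (u ∷ us) ≡ suc (countGt c us)
countGt-accept us p rewrite <ᵇ-true p = refl

countGt-reject : ∀ {c u} us → u ≤ c → countGt c (u ∷ us) ≡ countGt c us
countGt-reject us p rewrite <ᵇ-false p = refl

countLt-≥1 : ∀ {c u us} → u ∈ us → u < c → 1 ≤ countLt c us
countLt-≥1 {c} {us = v ∷ us} m p with v <? c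
... | yes q rewrite countLt-accept us q = s≤s z≤n
countLt-≥1 {us = v ∷ us} (here refl) p | no q = ⊥-elim (q p)
countLt-≥1 {us = v ∷ us} (there m) p | no q rewrite countLt-reject us (≮⇒≥ q) = countLt-≥1 m p

countGt-≥1 : ∀ {c u us} → u ∈ us → c < u → 1 ≤ countGt c us
countGt-≥1 {c} {us = v ∷ us} m p with c <? v
... | yes q rewrite countGt-accept us q = s≤s z≤n
countGt-≥1 {us = v ∷ us} (here refl) p | no q = ⊥-elim (q p)
countGt-≥1 {us = v ∷ us} (there m) p | no q rewrite countGt-reject us (≮⇒≥ q) = countGt-≥1 m p

countLt-≡0 : ∀ {c} us → (∀ {u} → u ∈ us → c ≤ u) → countLt c us ≡ 0
countLt-≡0 [] f = refl
countLt-≡0 (u ∷ us) f rewrite countLt-reject us (f (here refl)) = countLt-≡0 us (f ∘′ there)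

countGt-≡0 : ∀ {c} us → (∀ {u} → u ∈ us → u ≤ c) → countGt c us ≡ 0
countGt-≡0 [] f = refl
countGt-≡0 (u ∷ us) f rewrite countGt-reject us (f (here refl)) = countGt-≡0 us (f ∘′ there)

countLt-witness : ∀ {c} us → 1 ≤ countLt c us → Σ ℕ λ u → u ∈ us × u < c
countLt-witness {c} (u ∷ us) p with u <? c
... | yes q = u , here refl , q
... | no q rewrite countLt-reject us (≮⇒≥ q) with countLt-witness us p
... | v , m , r = v , there m , r

-- Runs

values : List Letter → List ℕ
values = map proj₁

Decreasing : List ℕ → Set
Decreasing = AllPairs _>_

NonEmpty : List Letter → Set
NonEmpty [] = ⊥
NonEmpty (_ ∷ _) = ⊤

headValue : List Letter → ℕ
headValue [] = 0
headValue (l ∷ _) = proj₁ l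

lastValue : List ℕ → ℕ
lastValue [] = 0
lastValue (x ∷ []) = x
lastValue (x ∷ y ∷ xs) = lastValue (y ∷ xs)

Decreasing-below-head : ∀ {x xs y} → Decreasing (x ∷ xs) → y ∈ xs → y < x
Decreasing-below-head (a ∷ _) m = All.lookup a m

Decreasing-≤head : ∀ {x xs y} → Decreasing (x ∷ xs) → y ∈ x ∷ xs → y ≤ x
Decreasing-≤head s (here refl) = ≤-refl
Decreasing-≤head s (there m) = <⇒≤ (Decreasing-below-head s m)

headValue-∈ : ∀ X → NonEmpty X → headValue X ∈ values X
headValue-∈ (l ∷ X) _ = here refl

headValue-≥ : ∀ {x} X → Decreasing (values X) → x ∈ values X → x ≤ headValue X
headValue-≥ (l ∷ X) s m = Decreasing-≤head s m

lastValue-∈ : ∀ x xs → lastValue (x ∷ xs) ∈ x ∷ xs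
lastValue-∈ x [] = here refl
lastValue-∈ x (y ∷ xs) = there (lastValue-∈ y xs)

lastValue-∈values : ∀ X → NonEmpty X → lastValue (values X) ∈ values X
lastValue-∈values (l ∷ X) _ = lastValue-∈ (proj₁ l) (values X)

lastValue-≤ : ∀ {z} xs → Decreasing xs → z ∈ xs → lastValue xs ≤ z
lastValue-≤ (x ∷ []) s (here refl) = ≤-refl
lastValue-≤ (x ∷ y ∷ xs) s (here refl) = Decreasing-≤head s (there (lastValue-∈ y xs))
lastValue-≤ (x ∷ y ∷ xs) (_ ∷ s) (there m) = lastValue-≤ (y ∷ xs) s m

headValue-values : ∀ {X Y} → values X ≡ values Y → headValue X ≡ headValue Y
headValue-values {[]} {[]} e = refl
headValue-values {_ ∷ _} {_ ∷ _} e = ∷-injectiveˡ e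

NonEmpty-values : ∀ {X Y} → values X ≡ values Y → NonEmpty X → NonEmpty Y
NonEmpty-values {_ ∷ _} {_ ∷ _} e _ = tt

∈⇒NonEmpty : ∀ {x} X → x ∈ values X → NonEmpty X
∈⇒NonEmpty (_ ∷ _) _ = tt

∈-values⁻ : ∀ {x} X → x ∈ values X → Σ Bool λ b → (x , b) ∈ X
∈-values⁻ X m with ∈-map⁻ proj₁ m
... | (_ , b) , l , refl = b , l

undec-⊆ : ∀ {x} X → x ∈ undec X → x ∈ values X
undec-⊆ ((v , true) ∷ X) m = there (undec-⊆ X m)
undec-⊆ ((v , false) ∷ X) (here refl) = here refl
undec-⊆ ((v , false) ∷ X) (there m) = there (undec-⊆ X m)

undec-∈ : ∀ {x} X → (x , false) ∈ X → x ∈ undec X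
undec-∈ ((v , true) ∷ X) (there m) = undec-∈ X m
undec-∈ ((v , false) ∷ X) (here refl) = here refl
undec-∈ ((v , false) ∷ X) (there m) = there (undec-∈ X m)

decorated-∉undec : ∀ {x} X → Decreasing (values X) → (x , true) ∈ X → x ∉ undec X
decorated-∉undec ((v , true) ∷ X) (a ∷ s) (here refl) m = <-irrefl refl (All.lookup a (undec-⊆ X m))
decorated-∉undec ((v , true) ∷ X) (a ∷ s) (there l) m = decorated-∉undec X s l m
decorated-∉undec ((v , false) ∷ X) (a ∷ s) (there l) (here refl) = <-irrefl refl (All.lookup a (∈-map⁺ proj₁ l))
decorated-∉undec ((v , false) ∷ X) (a ∷ s) (there l) (there m) = decorated-∉undec X s l m

∉undec⇒decorated : ∀ {x b} X → (x , b) ∈ X → x ∉ undec X → b ≡ true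
∉undec⇒decorated {b = true} X l n = refl
∉undec⇒decorated {b = false} X l n = ⊥-elim (n (undec-∈ X l))

undec-Decreasing : ∀ X → Decreasing (values X) → Decreasing (undec X)
undec-Decreasing [] s = []
undec-Decreasing ((v , true) ∷ X) (a ∷ s) = undec-Decreasing X s
undec-Decreasing ((v , false) ∷ X) (a ∷ s) =
  All.tabulate (λ m → All.lookup a (undec-⊆ X m)) ∷ undec-Decreasing X s

All-undec⁺ : ∀ {P : ℕ → Set} X → All (λ l → proj₂ l ≡ false → P (proj₁ l)) X → All P (undec X)
All-undec⁺ [] _ = []
All-undec⁺ ((v , true) ∷ X) (p ∷ ps) = All-undec⁺ X ps
All-undec⁺ ((v , false) ∷ X) (p ∷ ps) = p refl ∷ All-undec⁺ X ps

All-undec⁻ : ∀ {P : ℕ → Set} X → All P (undec X) → All (λ l → proj₂ l ≡ false → P (proj₁ l)) X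
All-undec⁻ [] _ = []
All-undec⁻ ((v , true) ∷ X) ps = (λ ()) ∷ All-undec⁻ X ps
All-undec⁻ ((v , false) ∷ X) (p ∷ ps) = (λ _ → p) ∷ All-undec⁻ X ps

run-determined-by-undec : ∀ X₁ X₂ → values X₁ ≡ values X₂ → Decreasing (values X₁) →
  undec X₁ ≡ undec X₂ → X₁ ≡ X₂
run-determined-by-undec [] [] _ _ _ = refl
run-determined-by-undec ((v , b₁) ∷ X₁) ((v₂ , b₂) ∷ X₂) ev (a ∷ s) eu with ∷-injectiveˡ ev
... | refl = go b₁ b₂ eu
  where
  et = ∷-injectiveʳ ev
  go : ∀ b₁ b₂ → undec ((v , b₁) ∷ X₁) ≡ undec ((v , b₂) ∷ X₂) → (v , b₁) ∷ X₁ ≡ (v , b₂) ∷ X₂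
  go true true e = cong ((v , true) ∷_) (run-determined-by-undec X₁ X₂ et s e)
  go false false e = cong ((v , false) ∷_) (run-determined-by-undec X₁ X₂ et s (∷-injectiveʳ e))
  go false true e = ⊥-elim (<-irrefl refl (All.lookup a (subst (v ∈_) (sym et) (undec-⊆ X₂ (subst (v ∈_) e (here refl))))))
  go true false e = ⊥-elim (<-irrefl refl (All.lookup a (undec-⊆ X₁ (subst (v ∈_) (sym e) (here refl)))))

RunChain : List (List Letter) → Set
RunChain [] = ⊤
RunChain (r ∷ []) = NonEmpty r × Decreasing (values r)
RunChain (r ∷ r′ ∷ rs) = NonEmpty r × Decreasing (values r) × lastValue (values r) < headValue r′ ×
  (∀ {x} → x ∈ values r → x ∉ values r′) × RunChain (r′ ∷ rs)

concat-runs : ∀ w → concat (runs w) ≡ w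
concat-runs [] = refl
concat-runs (x ∷ xs) with runs xs | concat-runs xs
... | [] | e = cong (x ∷_) e
... | [] ∷ rs | e = cong (x ∷_) e
... | (y ∷ r) ∷ rs | e with proj₁ y <ᵇ proj₁ x
... | true = cong (x ∷_) e
... | false = cong (x ∷_) e

∈-runs⇒∈ : ∀ {z r} w → z ∈ values r → r ∈ runs w → z ∈ values w
∈-runs⇒∈ {z} w m k = subst (λ u → z ∈ values u) (concat-runs w) (go (runs w) m k)
  where
  go : ∀ {r} rs → z ∈ values r → r ∈ rs → z ∈ values (concat rs)
  go (r ∷ rs) m (here refl) rewrite map-++ proj₁ r (concat rs) = ∈-++⁺ˡ m
  go (r ∷ rs) m (there k) rewrite map-++ proj₁ r (concat rs) = ∈-++⁺ʳ (values r) (go rs m k)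

runs-RunChain : ∀ w → Unique (values w) → RunChain (runs w)
runs-RunChain [] _ = tt
runs-RunChain (x ∷ xs) (nx ∷ u) with runs xs in eq | runs-RunChain xs u
... | [] | c = tt , [] ∷ []
... | [] ∷ [] | () , _
... | [] ∷ _ ∷ _ | () , _
... | (y ∷ r) ∷ rs | c with proj₁ y <ᵇ proj₁ x in lt
...   | true = grow rs eq c
  where
  y<x = <ᵇ-true⁻ lt
  grow : ∀ rs → runs xs ≡ (y ∷ r) ∷ rs → RunChain ((y ∷ r) ∷ rs) → RunChain ((x ∷ y ∷ r) ∷ rs)
  grow [] _ (_ , s) = tt , (y<x ∷ All.map (λ p → <-trans p y<x) (AllPairs.head s)) ∷ s
  grow (r′ ∷ rs) eq (_ , s , asc , dj , c) =
    tt , (y<x ∷ All.map (λ p → <-trans p y<x) (AllPairs.head s)) ∷ s , asc ,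
    (λ { (here refl) m → All¬⇒¬Any nx (∈-runs⇒∈ xs m (subst (r′ ∈_) (sym eq) (there (here refl))))
       ; (there m₁) m₂ → dj m₁ m₂ }) , c
...   | false = tt , [] ∷ [] , ≤∧≢⇒< (<ᵇ-false⁻ lt) (λ e → notNext (subst (_∈ values (y ∷ r)) (sym e) (here refl))) ,
                (λ { (here refl) → notNext }) , c
  where
  notNext : proj₁ x ∉ values (y ∷ r)
  notNext m = All¬⇒¬Any nx (∈-runs⇒∈ xs m (subst ((y ∷ r) ∈_) (sym eq) (here refl)))

runs-values : ∀ w₁ w₂ → values w₁ ≡ values w₂ → map values (runs w₁) ≡ map values (runs w₂)
runs-values [] [] _ = refl
runs-values (x₁ ∷ xs₁) (x₂ ∷ xs₂) e with ∷-injectiveˡ e | runs-values xs₁ xs₂ (∷-injectiveʳ e)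
... | ex | ih with runs xs₁ | runs xs₂
... | [] | [] = cong (λ z → (z ∷ []) ∷ []) ex
... | [] ∷ rs₁ | [] ∷ rs₂ = cong₂ _∷_ (cong (_∷ []) ex) (∷-injectiveʳ ih)
... | (y₁ ∷ r₁) ∷ rs₁ | (y₂ ∷ r₂) ∷ rs₂ with ∷-injectiveˡ (∷-injectiveˡ ih)
...   | ey with proj₁ y₁ <ᵇ proj₁ x₁ in c₁ | proj₁ y₂ <ᵇ proj₁ x₂ in c₂
...     | true | true = cong₂ _∷_ (cong₂ _∷_ ex (∷-injectiveˡ ih)) (∷-injectiveʳ ih)
...     | false | false = cong₂ _∷_ (cong (_∷ []) ex) ih
...     | true | false = ⊥-elim (true≢false (trans (sym c₁) (trans (cong₂ _<ᵇ_ ey ex) c₂)))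
...     | false | true = ⊥-elim (true≢false (trans (sym c₂) (trans (cong₂ _<ᵇ_ (sym ey) (sym ex)) c₁)))

RunChain-values : ∀ rs₁ rs₂ → map values rs₁ ≡ map values rs₂ → RunChain rs₁ → RunChain rs₂
RunChain-values [] [] e c = tt
RunChain-values (r₁ ∷ []) (r₂ ∷ []) e (ne , s) = NonEmpty-values e₁ ne , subst Decreasing e₁ s
  where e₁ = ∷-injectiveˡ e
RunChain-values (r₁ ∷ r₁′ ∷ rs₁) (r₂ ∷ r₂′ ∷ rs₂) e (ne , s , asc , dj , c) =
  NonEmpty-values e₁ ne , subst Decreasing e₁ s , subst₂ _<_ (cong lastValue e₁) (headValue-values e₂) asc ,
  (λ {x} m₁ m₂ → dj (subst (x ∈_) (sym e₁) m₁) (subst (x ∈_) (sym e₂) m₂)) ,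
  RunChain-values (r₁′ ∷ rs₁) (r₂′ ∷ rs₂) (∷-injectiveʳ e) c
  where
  e₁ = ∷-injectiveˡ e
  e₂ = ∷-injectiveˡ (∷-injectiveʳ e)

RunChain-decreasing : ∀ rs → RunChain rs → ∀ i → Decreasing (values (runAt rs i))
RunChain-decreasing [] c i = []
RunChain-decreasing (r ∷ []) (_ , s) zero = s
RunChain-decreasing (r ∷ []) _ (suc i) = []
RunChain-decreasing (r ∷ r′ ∷ rs) (_ , s , _) zero = s
RunChain-decreasing (r ∷ r′ ∷ rs) (_ , _ , _ , _ , c) (suc i) = RunChain-decreasing (r′ ∷ rs) c i

RunChain-nonEmpty : ∀ rs → RunChain rs → ∀ i → i < length rs → NonEmpty (runAt rs i)
RunChain-nonEmpty (r ∷ []) (ne , _) zero _ = ne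
RunChain-nonEmpty (r ∷ r′ ∷ rs) (ne , _) zero _ = ne
RunChain-nonEmpty (r ∷ []) _ (suc i) (s≤s ())
RunChain-nonEmpty (r ∷ r′ ∷ rs) (_ , _ , _ , _ , c) (suc i) (s≤s p) = RunChain-nonEmpty (r′ ∷ rs) c i p

RunChain-disjoint : ∀ rs → RunChain rs → ∀ i {x} → x ∈ values (runAt rs i) → x ∉ values (runAt rs (suc i))
RunChain-disjoint (r ∷ r′ ∷ rs) (_ , _ , _ , dj , c) zero m₁ m₂ = dj m₁ m₂
RunChain-disjoint (r ∷ r′ ∷ rs) (_ , _ , _ , _ , c) (suc i) m₁ m₂ = RunChain-disjoint (r′ ∷ rs) c i m₁ m₂

runAt-values : ∀ rs₁ rs₂ → map values rs₁ ≡ map values rs₂ → ∀ i → values (runAt rs₁ i) ≡ values (runAt rs₂ i)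
runAt-values [] [] e i = refl
runAt-values (r₁ ∷ rs₁) (r₂ ∷ rs₂) e zero = ∷-injectiveˡ e
runAt-values (r₁ ∷ rs₁) (r₂ ∷ rs₂) e (suc i) = runAt-values rs₁ rs₂ (∷-injectiveʳ e) i

runAt-beyond : ∀ (rs : List (List Letter)) i → length rs ≤ i → runAt rs i ≡ []
runAt-beyond [] i p = refl
runAt-beyond (r ∷ rs) (suc i) (s≤s p) = runAt-beyond rs i p

runAt-injective : ∀ (rs₁ rs₂ : List (List Letter)) → length rs₁ ≡ length rs₂ → (∀ i → runAt rs₁ i ≡ runAt rs₂ i) →
  rs₁ ≡ rs₂
runAt-injective [] [] _ _ = refl
runAt-injective (r₁ ∷ rs₁) (r₂ ∷ rs₂) e f =
  cong₂ _∷_ (f zero) (runAt-injective rs₁ rs₂ (suc-injective e) (λ i → f (suc i)))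

map-≡⇒length≡ : ∀ {A B : Set} (f : A → B) xs ys → map f xs ≡ map f ys → length xs ≡ length ys
map-≡⇒length≡ f xs ys e = trans (sym (length-map f xs)) (trans (cong length e) (length-map f ys))

undecAt : List (List Letter) → ℕ → List ℕ
undecAt rs i = undec (runAt rs i)

undecAt-beyond : ∀ {rs₁ rs₂} → length rs₁ ≡ length rs₂ → ∀ i → length rs₁ ≤ i → undecAt rs₁ i ≡ undecAt rs₂ i
undecAt-beyond {rs₁} {rs₂} eL i p rewrite runAt-beyond rs₁ i p | runAt-beyond rs₂ i (subst (_≤ i) eL p) = refl

totalUndec : List (List Letter) → ℕ
totalUndec [] = 0
totalUndec (r ∷ rs) = length (undec r) + totalUndec rs

totalUndec-cong : ∀ xs ys → length xs ≡ length ys → (∀ i → undecAt xs i ≡ undecAt ys i) → totalUndec xs ≡ totalUndec ys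
totalUndec-cong [] [] _ _ = refl
totalUndec-cong (x ∷ xs) (y ∷ ys) e f = cong₂ _+_ (cong length (f 0)) (totalUndec-cong xs ys (suc-injective e) (λ i → f (suc i)))

-- Conditions between consecutive runs

-- The schedule number of a letter c of a negative run with undecorated set U, followed by a run with
-- undecorated set B.
score : List ℕ → List ℕ → ℕ → ℕ
score U B c = countLt c U + countGt c B

NegativeCondition : List Letter → List ℕ → Set
NegativeCondition X B = All (λ l → score (undec X) B (proj₁ l) ≡ 1) X

ZeroCondition : List Letter → Set
ZeroCondition X = All (λ l → proj₂ l ≡ false → countGt (proj₁ l) (undec X) ≡ 0) X

-- B is the undecorated set of the run after X.  The condition concerns the decorated letters of X
-- and the undecorated letters of the next run, which is positive.
NonNegativeCondition : List Letter → List ℕ → Set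
NonNegativeCondition X B =
  All (λ l → proj₂ l ≡ true → score (undec X) B (proj₁ l) ≡ 1) X × All (λ b → score (undec X) B b ≡ 1) B

IsPivot : List Letter → List ℕ → ℕ → Set
IsPivot X [] g = g ∈ values X × (∀ x → x ∈ values X → g ≤ x)
IsPivot X (b ∷ _) g = g ∈ values X × g < b × (∀ x → x ∈ values X → x < b → x ≤ g)

PivotShape : List Letter → ℕ → List ℕ → Set
PivotShape X g U = (U ≡ g ∷ []) ⊎ ((U ≡ headValue X ∷ g ∷ []) × g < headValue X)

HasPivotShape : List Letter → List ℕ → List ℕ → Set
HasPivotShape X B U = Σ ℕ λ g → IsPivot X B g × PivotShape X g U

isPivot-∷ : ∀ {X b B g} → g ∈ values X → g < b → (∀ x → x ∈ values X → g < x → x < b → ⊥) → IsPivot X (b ∷ B) g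
isPivot-∷ m p f = m , p , λ x mx xb → ≮⇒≥ (λ gx → f x mx gx xb)

isPivot-∈ : ∀ X B {g} → IsPivot X B g → g ∈ values X
isPivot-∈ X [] (m , _) = m
isPivot-∈ X (b ∷ B) (m , _) = m

isPivot-unique : ∀ X B {g₁ g₂} → IsPivot X B g₁ → IsPivot X B g₂ → g₁ ≡ g₂
isPivot-unique X [] (m₁ , f₁) (m₂ , f₂) = ≤-antisym (f₁ _ m₂) (f₂ _ m₁)
isPivot-unique X (b ∷ B) (m₁ , p₁ , f₁) (m₂ , p₂ , f₂) = ≤-antisym (f₂ _ m₁ p₁) (f₁ _ m₂ p₂)

isPivot-values : ∀ {X Y} B {g} → values X ≡ values Y → IsPivot X B g → IsPivot Y B g
isPivot-values {X} {Y} [] {g} e (m , f) = subst (g ∈_) e m , λ x mx → f x (subst (x ∈_) (sym e) mx)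
isPivot-values {X} {Y} (b ∷ B) {g} e (m , p , f) = subst (g ∈_) e m , p , λ x mx → f x (subst (x ∈_) (sym e) mx)

isPivot-unique′ : ∀ {X₁ X₂ B₁ B₂ g₁ g₂} → values X₁ ≡ values X₂ → B₁ ≡ B₂ →
  IsPivot X₁ B₁ g₁ → IsPivot X₂ B₂ g₂ → g₁ ≡ g₂
isPivot-unique′ {X₁} {B₁ = B₁} ev refl p₁ p₂ = isPivot-unique X₁ B₁ p₁ (isPivot-values B₁ (sym ev) p₂)

pivotShape-pivot∈ : ∀ {X g U} → PivotShape X g U → g ∈ U
pivotShape-pivot∈ (inj₁ refl) = here refl
pivotShape-pivot∈ (inj₂ (refl , _)) = there (here refl)

pivotShape-≥pivot : ∀ {X g U} → PivotShape X g U → ∀ {u} → u ∈ U → g ≤ u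
pivotShape-≥pivot (inj₁ refl) (here refl) = ≤-refl
pivotShape-≥pivot (inj₂ (refl , p)) (here refl) = <⇒≤ p
pivotShape-≥pivot (inj₂ (refl , p)) (there (here refl)) = ≤-refl

pivotShape-nonEmpty : ∀ {X g U} → PivotShape X g U → Σ ℕ λ b → Σ (List ℕ) λ B → U ≡ b ∷ B
pivotShape-nonEmpty (inj₁ e) = _ , _ , e
pivotShape-nonEmpty (inj₂ (e , _)) = _ , _ , e

pivotShape-length≤1 : ∀ {X g U} → PivotShape X g U → length U ≤ 1 → U ≡ g ∷ []
pivotShape-length≤1 (inj₁ e) _ = e
pivotShape-length≤1 (inj₂ (refl , _)) (s≤s ())

∉-singleton : ∀ {x u : ℕ} → x ≢ u → x ∉ u ∷ []
∉-singleton ne (here e) = ne e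

∉-pair : ∀ {x u v : ℕ} → x ≢ u → x ≢ v → x ∉ u ∷ v ∷ []
∉-pair n₁ n₂ (here e) = n₁ e
∉-pair n₁ n₂ (there (here e)) = n₂ e

countGt-head≡0 : ∀ {b} B → Decreasing (b ∷ B) → countGt b (b ∷ B) ≡ 0
countGt-head≡0 {b} B s = countGt-≡0 (b ∷ B) (Decreasing-≤head s)

countGt-≥head≡0 : ∀ {x b} B → Decreasing (b ∷ B) → b ≤ x → countGt x (b ∷ B) ≡ 0
countGt-≥head≡0 {b = b} B s p = countGt-≡0 (b ∷ B) (λ m → ≤-trans (Decreasing-≤head s m) p)

countLt-singleton≡1 : ∀ {b u} → countLt b (u ∷ []) ≡ 1 → u < b
countLt-singleton≡1 {b} {u} e with u <? b
... | yes p = p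
... | no p rewrite countLt-reject {b} {u} [] (≮⇒≥ p) = ⊥-elim (0≢1+n e)

countLt-pair≡1 : ∀ {b u₁ u₂} → u₂ < u₁ → countLt b (u₁ ∷ u₂ ∷ []) ≡ 1 → u₂ < b × b ≤ u₁
countLt-pair≡1 {b} {u₁} {u₂} q e with u₁ <? b | u₂ <? b
... | yes p₁ | yes p₂ rewrite countLt-accept {b} {u₁} (u₂ ∷ []) p₁ | countLt-accept {b} {u₂} [] p₂ =
  ⊥-elim (0≢1+n (sym (suc-injective e)))
... | yes p₁ | no p₂ = ⊥-elim (p₂ (<-trans q p₁))
... | no p₁ | yes p₂ = p₂ , ≮⇒≥ p₁
... | no p₁ | no p₂ rewrite countLt-reject {b} {u₁} (u₂ ∷ []) (≮⇒≥ p₁) | countLt-reject {b} {u₂} [] (≮⇒≥ p₂) =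
  ⊥-elim (0≢1+n e)

countGt-pair≥2 : ∀ {x h g : ℕ} → x < g → g < h → 2 ≤ countGt x (h ∷ g ∷ [])
countGt-pair≥2 {x} {h} {g} p q rewrite countGt-accept {x} {h} (g ∷ []) (<-trans p q) | countGt-accept {x} {g} [] p =
  s≤s (s≤s z≤n)

run-minimum : ∀ W → NonEmpty W → Decreasing (values W) → Σ ℕ λ m → m ∈ values W × (∀ {u} → u ∈ values W → m ≤ u)
run-minimum W ne s = lastValue (values W) , lastValue-∈values W ne , lastValue-≤ (values W) s

negative-at : ∀ {X B x} → NegativeCondition X B → x ∈ values X → score (undec X) B x ≡ 1
negative-at {X} u m with ∈-values⁻ X m
... | _ , l = All.lookup u l

nonNegative-decorated : ∀ {X B x} → NonNegativeCondition X B → x ∈ values X → x ∉ undec X → score (undec X) B x ≡ 1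
nonNegative-decorated {X} (d , _) m n with ∈-values⁻ X m
... | _ , l = All.lookup d l (∉undec⇒decorated X l n)

zero-undec-length≤1 : ∀ X → Decreasing (values X) → ZeroCondition X → length (undec X) ≤ 1
zero-undec-length≤1 X s z = go (undec X) (undec-Decreasing X s) (All-undec⁺ X z)
  where
  go : ∀ U → Decreasing U → All (λ u → countGt u U ≡ 0) U → length U ≤ 1
  go [] _ _ = z≤n
  go (u ∷ []) _ _ = s≤s z≤n
  go (u₁ ∷ u₂ ∷ U) s (_ ∷ p ∷ _) =
    ⊥-elim (1+n≰n (subst (1 ≤_) p (countGt-≥1 (here refl) (Decreasing-below-head s (here refl)))))

nonNegative-next-length≤2 : ∀ {W U} → Decreasing U → NonNegativeCondition W U → length U ≤ 2
nonNegative-next-length≤2 {W} {U} s (_ , p) = go U s p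
  where
  go : ∀ U → Decreasing U → All (λ u → countLt u (undec W) + countGt u U ≡ 1) U → length U ≤ 2
  go [] _ _ = z≤n
  go (u ∷ []) _ _ = s≤s z≤n
  go (u ∷ v ∷ []) _ _ = s≤s (s≤s z≤n)
  go (u₁ ∷ u₂ ∷ u₃ ∷ U) s (_ ∷ _ ∷ p ∷ _) = ⊥-elim (2≤n⇒m+n≢1 c p)
    where
    c : 2 ≤ countGt u₃ (u₁ ∷ u₂ ∷ u₃ ∷ U)
    c rewrite countGt-accept {u₃} {u₁} (u₂ ∷ u₃ ∷ U) (Decreasing-below-head s (there (here refl)))
            | countGt-accept {u₃} {u₂} (u₃ ∷ U) (Decreasing-below-head (AllPairs.tail s) (here refl)) = s≤s (s≤s z≤n)

OutsideScoreOne : List Letter → List ℕ → List ℕ → Set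
OutsideScoreOne X U B = ∀ x → x ∈ values X → x ∉ U → score U B x ≡ 1

-- A letter of X above both undecorated letters would score 2.
pair-head≡headValue : ∀ X {B u₁ u₂} → Decreasing (values X) → NonEmpty X → Decreasing (u₁ ∷ u₂ ∷ []) →
  u₁ ∈ values X → OutsideScoreOne X (u₁ ∷ u₂ ∷ []) B → u₁ ≡ headValue X
pair-head≡headValue X {B} {u₁} {u₂} sX ne sU m t with m≤n⇒m<n∨m≡n (headValue-≥ X sX m)
... | inj₂ e = e
... | inj₁ p = ⊥-elim (2≤m⇒m+n≢1 c (t (headValue X) (headValue-∈ X ne) (∉-pair (>⇒≢ p) (>⇒≢ q))))
  where
  q = <-trans (Decreasing-below-head sU (here refl)) p
  c : 2 ≤ countLt (headValue X) (u₁ ∷ u₂ ∷ [])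
  c rewrite countLt-accept {headValue X} {u₁} (u₂ ∷ []) p | countLt-accept {headValue X} {u₂} [] q = ≤-refl

nonNegative-pivotShape′ : ∀ X B U → Decreasing (values X) → NonEmpty X → Decreasing U → (∀ {u} → u ∈ U → u ∈ values X) →
  OutsideScoreOne X U B → All (λ b → score U B b ≡ 1) B → Decreasing B → length U ≤ 2 →
  HasPivotShape X B U
nonNegative-pivotShape′ X [] [] sX ne sU U⊆ t bt sB len = ⊥-elim (0≢1+n (t (headValue X) (headValue-∈ X ne) (λ ())))
nonNegative-pivotShape′ X [] (u ∷ []) sX ne sU U⊆ t bt sB len =
  u , (U⊆ (here refl) , λ x mx → ≮⇒≥ λ xu →
        m≡0∧n≡0⇒m+n≢1 (countLt-reject {x} {u} [] (<⇒≤ xu)) refl (t x mx (∉-singleton (<⇒≢ xu)))) ,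
  inj₁ refl
nonNegative-pivotShape′ X [] (u₁ ∷ u₂ ∷ []) sX ne sU U⊆ t bt sB len =
  u₂ , (U⊆ (there (here refl)) , λ x mx → ≮⇒≥ λ xu →
        m≡0∧n≡0⇒m+n≢1
          (countLt-≡0 (u₁ ∷ u₂ ∷ []) (λ { (here refl) → <⇒≤ (<-trans xu q) ; (there (here refl)) → <⇒≤ xu }))
          refl (t x mx (∉-pair (<⇒≢ (<-trans xu q)) (<⇒≢ xu)))) ,
  inj₂ (cong (_∷ u₂ ∷ []) e , subst (u₂ <_) e q)
  where
  q = Decreasing-below-head sU (here refl)
  e = pair-head≡headValue X {[]} sX ne sU (U⊆ (here refl)) t
nonNegative-pivotShape′ X (b ∷ B) [] sX ne sU U⊆ t (bt ∷ _) sB len =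
  ⊥-elim (0≢1+n (n≡0∧m+n≡1⇒m≡1 (countGt-head≡0 B sB) bt))
nonNegative-pivotShape′ X (b ∷ B) (u ∷ []) sX ne sU U⊆ t (bt ∷ _) sB len =
  u , isPivot-∷ {X} {b} {B} (U⊆ (here refl)) (countLt-singleton≡1 (n≡0∧m+n≡1⇒m≡1 (countGt-head≡0 B sB) bt))
        (λ x mx ux xb → 1≤m∧1≤n⇒m+n≢1 (countLt-≥1 (here refl) ux) (countGt-≥1 (here refl) xb)
                          (t x mx (∉-singleton (>⇒≢ ux)))) ,
  inj₁ refl
nonNegative-pivotShape′ X (b ∷ B) (u₁ ∷ u₂ ∷ []) sX ne sU U⊆ t (bt ∷ _) sB len =
  u₂ , isPivot-∷ {X} {b} {B} (U⊆ (there (here refl))) (proj₁ c)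
         (λ x mx ux xb → 1≤m∧1≤n⇒m+n≢1 (countLt-≥1 (there (here refl)) ux) (countGt-≥1 (here refl) xb)
            (t x mx (∉-pair (<⇒≢ (<-≤-trans xb (proj₂ c))) (>⇒≢ ux)))) ,
  inj₂ (cong (_∷ u₂ ∷ []) e , subst (u₂ <_) e q)
  where
  q = Decreasing-below-head sU (here refl)
  c = countLt-pair≡1 q (n≡0∧m+n≡1⇒m≡1 (countGt-head≡0 B sB) bt)
  e = pair-head≡headValue X {b ∷ B} sX ne sU (U⊆ (here refl)) t
nonNegative-pivotShape′ X B (_ ∷ _ ∷ _ ∷ _) sX ne sU U⊆ t bt sB (s≤s (s≤s ()))

negative-pivotShape′ : ∀ X b B U → Decreasing (values X) → NonEmpty X → Decreasing U → (∀ {u} → u ∈ U → u ∈ values X) →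
  (∀ x → x ∈ values X → score U (b ∷ B) x ≡ 1) → Decreasing (b ∷ B) →
  (U ≡ []) ⊎ HasPivotShape X (b ∷ B) U
negative-pivotShape′ X b B [] sX ne sU U⊆ t sB = inj₁ refl
negative-pivotShape′ X b B (u ∷ []) sX ne sU U⊆ t sB =
  inj₂ (u , isPivot-∷ {X} {b} {B} (U⊆ (here refl)) ub
              (λ x mx ux xb → 1≤m∧1≤n⇒m+n≢1 (countLt-≥1 (here refl) ux) (countGt-≥1 (here refl) xb) (t x mx)) ,
        inj₁ refl)
  where
  ub : u < b
  ub = ≰⇒> λ bu → m≡0∧n≡0⇒m+n≢1 (countLt-reject {u} {u} [] ≤-refl) (countGt-≥head≡0 B sB bu) (t u (U⊆ (here refl)))
negative-pivotShape′ X b B (u₁ ∷ u₂ ∷ []) sX ne sU U⊆ t sB =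
  inj₂ (u₂ , isPivot-∷ {X} {b} {B} (U⊆ (there (here refl))) ub
               (λ x mx ux xb → 1≤m∧1≤n⇒m+n≢1 (countLt-≥1 (there (here refl)) ux) (countGt-≥1 (here refl) xb) (t x mx)) ,
        inj₂ (cong (_∷ u₂ ∷ []) e , subst (u₂ <_) e q))
  where
  q = Decreasing-below-head sU (here refl)
  e = pair-head≡headValue X {b ∷ B} sX ne sU (U⊆ (here refl)) (λ x mx _ → t x mx)
  ub : u₂ < b
  ub = ≰⇒> λ bu → m≡0∧n≡0⇒m+n≢1
                    (countLt-≡0 (u₁ ∷ u₂ ∷ []) (λ { (here refl) → <⇒≤ q ; (there (here refl)) → ≤-refl }))
                    (countGt-≥head≡0 B sB bu) (t u₂ (U⊆ (there (here refl))))
negative-pivotShape′ X b B (u₁ ∷ u₂ ∷ u₃ ∷ U) sX ne sU U⊆ t sB = ⊥-elim (2≤m⇒m+n≢1 c (t u₁ (U⊆ (here refl))))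
  where
  c : 2 ≤ countLt u₁ (u₁ ∷ u₂ ∷ u₃ ∷ U)
  c rewrite countLt-reject {u₁} {u₁} (u₂ ∷ u₃ ∷ U) ≤-refl
          | countLt-accept {u₁} {u₂} (u₃ ∷ U) (Decreasing-below-head sU (here refl))
          | countLt-accept {u₁} {u₃} U (Decreasing-below-head sU (there (here refl))) = s≤s (s≤s z≤n)

nonNegative-pivotShape : ∀ X B → Decreasing (values X) → NonEmpty X → Decreasing B → NonNegativeCondition X B →
  length (undec X) ≤ 2 → HasPivotShape X B (undec X)
nonNegative-pivotShape X B sX ne sB c len =
  nonNegative-pivotShape′ X B (undec X) sX ne (undec-Decreasing X sX) (undec-⊆ X)
    (λ x mx n → nonNegative-decorated {X} {B} c mx n) (proj₂ c) sB len

negative-pivotShape : ∀ X b B → Decreasing (values X) → NonEmpty X → Decreasing (b ∷ B) → NegativeCondition X (b ∷ B) →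
  (undec X ≡ []) ⊎ HasPivotShape X (b ∷ B) (undec X)
negative-pivotShape X b B sX ne sB c =
  negative-pivotShape′ X b B (undec X) sX ne (undec-Decreasing X sX) (undec-⊆ X) (λ x mx → negative-at {X} {b ∷ B} c mx) sB

record AdmissibleNext (X : List Letter) (B : List ℕ) : Set where
  constructor admissible
  field
    decreasing : Decreasing B
    length≤2 : length B ≤ 2
    aboveSecond : ∀ {b₁ b₂} → B ≡ b₁ ∷ b₂ ∷ [] → ∀ x → x ∈ values X → b₂ < x
    disjoint : ∀ x → x ∈ values X → ∀ b → b ∈ B → x ≢ b

admissible-countGt≡1 : ∀ {X b B x} → AdmissibleNext X (b ∷ B) → x ∈ values X → x < b → countGt x (b ∷ B) ≡ 1
admissible-countGt≡1 {b = b} {[]} {x} _ _ p rewrite countGt-accept {x} {b} [] p = refl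
admissible-countGt≡1 {b = b} {b₂ ∷ []} {x} (admissible _ _ ab _) mx p
  rewrite countGt-accept {x} {b} (b₂ ∷ []) p | countGt-reject {x} {b₂} [] (<⇒≤ (ab refl x mx)) = refl
admissible-countGt≡1 {B = _ ∷ _ ∷ _} (admissible _ (s≤s (s≤s ())) _ _) _ _

isPivot-above⇒bound≤ : ∀ {X b B g x} → AdmissibleNext X (b ∷ B) → IsPivot X (b ∷ B) g → x ∈ values X → g < x → b ≤ x
isPivot-above⇒bound≤ {b = b} {x = x} adm (_ , _ , f) mx p with <-cmp x b
... | tri< q _ _ = ⊥-elim (<⇒≱ p (f x mx q))
... | tri≈ _ e _ = ⊥-elim (AdmissibleNext.disjoint adm x mx b (here refl) e)
... | tri> _ _ q = <⇒≤ q

headValue>bound : ∀ {X b B g} → NonEmpty X → AdmissibleNext X (b ∷ B) → IsPivot X (b ∷ B) g → g < headValue X → b < headValue X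
headValue>bound {X} ne adm pv r = ≤∧≢⇒< (isPivot-above⇒bound≤ adm pv (headValue-∈ X ne) r)
  (λ e → AdmissibleNext.disjoint adm _ (headValue-∈ X ne) _ (here refl) (sym e))

pivotShape-countLt≡0 : ∀ {X g U x} → PivotShape X g U → x ≤ g → countLt x U ≡ 0
pivotShape-countLt≡0 {X} {U = U} sh p = countLt-≡0 U (λ m → ≤-trans p (pivotShape-≥pivot {X} sh m))

pivotShape-countLt≡1 : ∀ {X g U x} → PivotShape X g U → g < x → x < headValue X → countLt x U ≡ 1
pivotShape-countLt≡1 {x = x} (inj₁ refl) p q rewrite countLt-accept {x} [] p = refl
pivotShape-countLt≡1 {X} {g} {x = x} (inj₂ (refl , r)) p q
  rewrite countLt-reject {x} {headValue X} (g ∷ []) (<⇒≤ q) | countLt-accept {x} {g} [] p = refl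

pivotShape-countLt≡1′ : ∀ {X g U x} → PivotShape X g U → g < x → x ∉ U → x ≤ headValue X → countLt x U ≡ 1
pivotShape-countLt≡1′ {x = x} (inj₁ refl) p n q rewrite countLt-accept {x} [] p = refl
pivotShape-countLt≡1′ {X} (inj₂ (refl , r)) p n q with m≤n⇒m<n∨m≡n q
... | inj₁ q′ = pivotShape-countLt≡1 {X} (inj₂ (refl , r)) p q′
... | inj₂ e = ⊥-elim (n (here e))

pivotShape-scoreOutside : ∀ X B {g U} → Decreasing (values X) → AdmissibleNext X B → IsPivot X B g → PivotShape X g U →
  OutsideScoreOne X U B
pivotShape-scoreOutside X B {g} {U} sX adm pv sh x mx n with <-cmp x g
... | tri≈ _ e _ = ⊥-elim (n (subst (_∈ U) (sym e) (pivotShape-pivot∈ {X} sh)))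
pivotShape-scoreOutside X [] sX adm pv sh x mx n | tri< p _ _ = ⊥-elim (<⇒≱ p (proj₂ pv x mx))
pivotShape-scoreOutside X (b ∷ B) sX adm pv sh x mx n | tri< p _ _
  rewrite pivotShape-countLt≡0 {X} sh (<⇒≤ p) = admissible-countGt≡1 adm mx (<-trans p (proj₁ (proj₂ pv)))
pivotShape-scoreOutside X [] sX adm pv sh x mx n | tri> _ _ p
  rewrite pivotShape-countLt≡1′ {X} sh p n (headValue-≥ X sX mx) = refl
pivotShape-scoreOutside X (b ∷ B) sX adm pv sh x mx n | tri> _ _ p
  rewrite pivotShape-countLt≡1′ {X} sh p n (headValue-≥ X sX mx)
        | countGt-≥head≡0 {x} B (AdmissibleNext.decreasing adm) (isPivot-above⇒bound≤ adm pv mx p) = refl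

pivotShape-nextScores : ∀ X B {g U} → NonEmpty X → AdmissibleNext X B → IsPivot X B g → PivotShape X g U →
  All (λ b → score U B b ≡ 1) B
pivotShape-nextScores X [] ne adm pv sh = []
pivotShape-nextScores X (b ∷ B) {g} {U} ne adm pv sh = first sh ∷ rest B adm
  where
  sB = AdmissibleNext.decreasing adm
  first : ∀ {U} → PivotShape X g U → score U (b ∷ B) b ≡ 1
  first {U} sh′ rewrite countGt-head≡0 B sB | +-identityʳ (countLt b U) with sh′
  ... | inj₁ refl rewrite countLt-accept {b} [] (proj₁ (proj₂ pv)) = refl
  ... | inj₂ (refl , r) = pivotShape-countLt≡1 {X} (inj₂ (refl , r)) (proj₁ (proj₂ pv)) (headValue>bound ne adm pv r)
  rest : ∀ B → AdmissibleNext X (b ∷ B) → All (λ b′ → countLt b′ U + countGt b′ (b ∷ B) ≡ 1) B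
  rest [] _ = []
  rest (b₂ ∷ []) (admissible sB′ _ ab _) = cong₂ _+_ below above ∷ []
    where
    below : countLt b₂ U ≡ 0
    below = pivotShape-countLt≡0 {X} sh (<⇒≤ (ab refl g (isPivot-∈ X (b ∷ b₂ ∷ []) pv)))
    above : countGt b₂ (b ∷ b₂ ∷ []) ≡ 1
    above = trans (countGt-accept (b₂ ∷ []) (Decreasing-below-head sB′ (here refl))) (cong suc (countGt-reject {b₂} [] ≤-refl))
  rest (_ ∷ _ ∷ _) (admissible _ (s≤s (s≤s ())) _ _)

pivotShape⇒nonNegative : ∀ X B g → Decreasing (values X) → NonEmpty X → AdmissibleNext X B → IsPivot X B g →
  PivotShape X g (undec X) → NonNegativeCondition X B
pivotShape⇒nonNegative X B g sX ne adm pv sh =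
  All.tabulate (λ { {x , b} lm refl → pivotShape-scoreOutside X B sX adm pv sh x (∈-map⁺ proj₁ lm) (decorated-∉undec X sX lm) }) ,
  pivotShape-nextScores X B ne adm pv sh

pivotShape⇒negative : ∀ X b B g → Decreasing (values X) → NonEmpty X → AdmissibleNext X (b ∷ B) → IsPivot X (b ∷ B) g →
  PivotShape X g (undec X) → NegativeCondition X (b ∷ B)
pivotShape⇒negative X b B g sX ne adm pv sh = All.tabulate λ {l} lm → scores (proj₁ l) (∈-map⁺ proj₁ lm) sh
  where
  scores : ∀ x {U} → x ∈ values X → PivotShape X g U → score U (b ∷ B) x ≡ 1
  scores x {U} mx sh with x ≟ g
  ... | yes refl rewrite pivotShape-countLt≡0 {X} {x} {U} {x} sh ≤-refl = admissible-countGt≡1 adm mx (proj₁ (proj₂ pv))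
  scores x mx sh@(inj₁ refl) | no n = pivotShape-scoreOutside X (b ∷ B) sX adm pv sh x mx (∉-singleton n)
  scores x mx sh@(inj₂ (refl , r)) | no n with x ≟ headValue X
  ... | yes refl rewrite countLt-reject {x} {x} (g ∷ []) ≤-refl | countLt-accept {x} {g} [] r
        | countGt-≥head≡0 {x} B (AdmissibleNext.decreasing adm) (<⇒≤ (headValue>bound ne adm pv r)) = refl
  ... | no n₂ = pivotShape-scoreOutside X (b ∷ B) sX adm pv sh x mx (∉-pair n₂ n)

noUndec⇒negative : ∀ X b B → undec X ≡ [] → AdmissibleNext X (b ∷ B) → (∀ x → x ∈ values X → x < b) →
  NegativeCondition X (b ∷ B)
noUndec⇒negative X b B e adm f = All.tabulate λ {l} lm →
  subst (λ U → score U (b ∷ B) (proj₁ l) ≡ 1) (sym e) (admissible-countGt≡1 adm (∈-map⁺ proj₁ lm) (f _ (∈-map⁺ proj₁ lm)))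

LeftCompatible : List Letter → List ℕ → Set
LeftCompatible W U =
  (∀ {g} → U ≡ g ∷ [] → Σ ℕ λ x → x ∈ values W × x < g) ×
  (∀ {h g} → U ≡ h ∷ g ∷ [] → g < h → ∀ x → x ∈ values W → x < g → ⊥)

nonNegative⇒leftCompatible : ∀ {W U} → NonNegativeCondition W U → LeftCompatible W U
nonNegative⇒leftCompatible {W} c = (λ { refl → below c }) , (λ { refl → noneBelow c })
  where
  below : ∀ {g} → NonNegativeCondition W (g ∷ []) → Σ ℕ λ x → x ∈ values W × x < g
  below {g} (_ , t ∷ _) with countLt-witness (undec W) (≤-reflexive (sym (n≡0∧m+n≡1⇒m≡1 (countGt-reject {g} {g} [] ≤-refl) t)))
  ... | x , m , p = x , undec-⊆ W m , p
  noneBelow : ∀ {h g} → NonNegativeCondition W (h ∷ g ∷ []) → g < h → ∀ x → x ∈ values W → x < g → ⊥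
  noneBelow {h} {g} (d , _ ∷ t ∷ _) gh x mx xg with ∈-values⁻ W mx
  ... | true , l = 2≤n⇒m+n≢1 (countGt-pair≥2 xg gh) (All.lookup d l refl)
  ... | false , l = 1+n≰n (subst (1 ≤_) noLetterBelow (countLt-≥1 (undec-∈ W l) xg))
    where
    noLetterBelow : countLt g (undec W) ≡ 0
    noLetterBelow = m+1≡1⇒m≡0 (trans (cong (countLt g (undec W) +_)
      (sym (trans (countGt-accept (g ∷ []) gh) (cong suc (countGt-reject {g} [] ≤-refl))))) t)

negative⇒leftCompatible : ∀ {W U} → NonEmpty W → Decreasing (values W) → NegativeCondition W U → LeftCompatible W U
negative⇒leftCompatible {W} ne s c = (λ { refl → below c }) , noneBelow c
  where
  noneBelow : ∀ {U} → NegativeCondition W U → ∀ {h g} → U ≡ h ∷ g ∷ [] → g < h → ∀ x → x ∈ values W → x < g → ⊥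
  noneBelow c {h} {g} refl gh x mx xg = 2≤n⇒m+n≢1 (countGt-pair≥2 xg gh) (negative-at {W} {h ∷ g ∷ []} c mx)
  below : ∀ {g} → NegativeCondition W (g ∷ []) → Σ ℕ λ x → x ∈ values W × x < g
  below {g} c with run-minimum W ne s
  ... | m , mm , ml = m , mm , ≰⇒> λ gm →
    m≡0∧n≡0⇒m+n≢1 (countLt-≡0 (undec W) (ml ∘′ undec-⊆ W)) (countGt-reject {m} {g} [] gm) (negative-at {W} {g ∷ []} c mm)

negative⇒nextNonEmpty : ∀ {W} → NonEmpty W → Decreasing (values W) → ¬ NegativeCondition W []
negative⇒nextNonEmpty {W} ne s c with run-minimum W ne s
... | m , mm , ml = m≡0∧n≡0⇒m+n≢1 (countLt-≡0 (undec W) (ml ∘′ undec-⊆ W)) refl (negative-at {W} {[]} c mm)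

pivotShape-unique : ∀ {X₁ X₂ W₁ W₂ g U₁ U₂} → PivotShape X₁ g U₁ → PivotShape X₂ g U₂ →
  headValue X₁ ≡ headValue X₂ → values W₁ ≡ values W₂ → LeftCompatible W₁ U₁ → LeftCompatible W₂ U₂ → U₁ ≡ U₂
pivotShape-unique (inj₁ refl) (inj₁ refl) eh ew l₁ l₂ = refl
pivotShape-unique (inj₂ (refl , _)) (inj₂ (refl , _)) eh ew l₁ l₂ = cong (_∷ _ ∷ []) eh
pivotShape-unique (inj₁ refl) (inj₂ (refl , r₂)) eh ew l₁ l₂ with proj₁ l₁ refl
... | x , mx , p = ⊥-elim (proj₂ l₂ refl r₂ x (subst (x ∈_) ew mx) p)
pivotShape-unique (inj₂ (refl , r₁)) (inj₁ refl) eh ew l₁ l₂ with proj₁ l₂ refl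
... | x , mx , p = ⊥-elim (proj₂ l₁ refl r₁ x (subst (x ∈_) (sym ew) mx) p)

single⇒zeroCondition : ∀ X {g} → undec X ≡ g ∷ [] → ZeroCondition X
single⇒zeroCondition X {g} e = All-undec⁻ X (subst (All (λ c → countGt c (undec X) ≡ 0)) (sym e)
  (subst (λ U → countGt g U ≡ 0) (sym e) (countGt-reject {g} {g} [] ≤-refl) ∷ []))

-- Schedule numbers

record LocalConditions (rs : List (List Letter)) (s i : ℕ) : Set where
  constructor local
  field
    atNegative : i < s → NegativeCondition (runAt rs i) (undecAt rs (suc i))
    atZero : i ≡ s → ZeroCondition (runAt rs i)
    atNonNegative : s ≤ i → NonNegativeCondition (runAt rs i) (undecAt rs (suc i))
open LocalConditions

ScheduleOneAt : List (List Letter) → ℕ → ℕ → Set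
ScheduleOneAt rs s i = All (λ c → schedule rs s i c ≡ 1) (runAt rs i)

module _ (rs : List (List Letter)) (s : ℕ) where
  private
    schedulesFrom : (ℕ → ℕ) → List (List Letter) → List ℕ
    schedulesFrom f xs = concat (map (λ ir → map (schedule rs s (proj₁ ir)) (proj₂ ir)) (zip (applyUpTo f (length xs)) xs))

    split : ∀ f xs → All (_≡ 1) (schedulesFrom f xs) → ∀ i → All (λ c → schedule rs s (f i) c ≡ 1) (runAt xs i)
    split f [] a i = []
    split f (r ∷ xs) a zero = map⁻ (proj₁ (++⁻ (map (schedule rs s (f 0)) r) a))
    split f (r ∷ xs) a (suc i) = split (f ∘′ suc) xs (proj₂ (++⁻ (map (schedule rs s (f 0)) r) a)) i

    join : ∀ f xs → (∀ i → All (λ c → schedule rs s (f i) c ≡ 1) (runAt xs i)) → All (_≡ 1) (schedulesFrom f xs)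
    join f [] g = []
    join f (r ∷ xs) g = ++⁺ (map⁺ (g zero)) (join (f ∘′ suc) xs (λ i → g (suc i)))

  schedules⇒runwise : All (_≡ 1) (schedules rs s) → ∀ i → ScheduleOneAt rs s i
  schedules⇒runwise = split (λ k → k) rs

  runwise⇒schedules : (∀ i → ScheduleOneAt rs s i) → All (_≡ 1) (schedules rs s)
  runwise⇒schedules = join (λ k → k) rs

module _ (rs : List (List Letter)) (s : ℕ) (s<l : s < length rs) where
  private
    inRange : (length rs ∸ 1 <ᵇ s) ≡ false
    inRange = go (length rs) s<l
      where
      go : ∀ L → s < L → (L ∸ 1 <ᵇ s) ≡ false
      go (suc L) p = <ᵇ-false (≤-pred p)

    schedule-decorated : ∀ i c → schedule rs s i (c , true) ≡ score (undecAt rs i) (undecAt rs (suc i)) c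
    schedule-decorated i c rewrite inRange = refl

    schedule-negative : ∀ i c → i < s → schedule rs s i (c , false) ≡ score (undecAt rs i) (undecAt rs (suc i)) c
    schedule-negative i c p rewrite inRange | <ᵇ-true p = refl

    schedule-zero : ∀ c → schedule rs s s (c , false) ≡ countGt c (undecAt rs s) + 1
    schedule-zero c rewrite inRange | <ᵇ-false {s} {s} ≤-refl | ≡ᵇ-refl s = refl

    -- A letter of the positive run i+1 is scored against run i, as in `NonNegativeCondition`.
    schedule-positive : ∀ i c → s ≤ i → schedule rs s (suc i) (c , false) ≡ score (undecAt rs i) (undecAt rs (suc i)) c
    schedule-positive i c p rewrite inRange | <ᵇ-false {suc i} {s} (m≤n⇒m≤1+n p) | ≢⇒≡ᵇ-false {suc i} {s} (>⇒≢ (s≤s p)) =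
      +-comm (countGt c (undecAt rs (suc i))) (countLt c (undecAt rs i))

  scheduleOne⇒local : (∀ i → ScheduleOneAt rs s i) → ∀ i → LocalConditions rs s i
  scheduleOne⇒local g i = local negative zeroRun nonNegative
    where
    negative : i < s → NegativeCondition (runAt rs i) (undecAt rs (suc i))
    negative p = All.tabulate λ
      { {c , true} m → trans (sym (schedule-decorated i c)) (All.lookup (g i) m)
      ; {c , false} m → trans (sym (schedule-negative i c p)) (All.lookup (g i) m) }
    zeroRun : i ≡ s → ZeroCondition (runAt rs i)
    zeroRun refl = All.tabulate λ
      { {c , false} m refl → m+1≡1⇒m≡0 (trans (sym (schedule-zero c)) (All.lookup (g i) m))
      ; {c , true} m () }
    nonNegative : s ≤ i → NonNegativeCondition (runAt rs i) (undecAt rs (suc i))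
    nonNegative p =
      All.tabulate (λ { {c , true} m refl → trans (sym (schedule-decorated i c)) (All.lookup (g i) m)
                      ; {c , false} m () }) ,
      All-undec⁺ (runAt rs (suc i)) (All.tabulate λ
        { {c , false} m refl → trans (sym (schedule-positive i c p)) (All.lookup (g (suc i)) m)
        ; {c , true} m () })

  local⇒scheduleOne : (∀ i → LocalConditions rs s i) → ∀ i → ScheduleOneAt rs s i
  local⇒scheduleOne h i = All.tabulate λ { {c , true} m → decorated c m ; {c , false} m → undecorated i c m }
    where
    decorated : ∀ c → (c , true) ∈ runAt rs i → schedule rs s i (c , true) ≡ 1
    decorated c m with i <? s
    ... | yes p = trans (schedule-decorated i c) (All.lookup (atNegative (h i) p) m)
    ... | no p = trans (schedule-decorated i c) (All.lookup (proj₁ (atNonNegative (h i) (≮⇒≥ p))) m refl)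
    undecorated : ∀ i c → (c , false) ∈ runAt rs i → schedule rs s i (c , false) ≡ 1
    undecorated i c m with <-cmp i s
    ... | tri< p _ _ = trans (schedule-negative i c p) (All.lookup (atNegative (h i) p) m)
    ... | tri≈ _ refl _ = trans (schedule-zero c) (cong (_+ 1) (All.lookup (atZero (h i) refl) m refl))
    undecorated zero c m | tri> _ _ ()
    undecorated (suc i) c m | tri> _ _ p = trans (schedule-positive i c (≤-pred p))
      (All.lookup (proj₂ (atNonNegative (h i) (≤-pred p))) (undec-∈ (runAt rs (suc i)) m))

-- Uniqueness

data Run0Shape (X : List Letter) (B : List ℕ) : Set where
  single : ∀ {g} → IsPivot X B g → undec X ≡ g ∷ [] → Run0Shape X B
  none : NegativeCondition X B → undec X ≡ [] → Run0Shape X B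
  double : ∀ {g} → NegativeCondition X B → IsPivot X B g → undec X ≡ headValue X ∷ g ∷ [] → g < headValue X → Run0Shape X B

module Shifted (rs : List (List Letter)) (ch : RunChain rs) (s : ℕ) (ad : ∀ i → LocalConditions rs s i) where
  private
    dec : ∀ i → Decreasing (values (runAt rs i))
    dec = RunChain-decreasing rs ch
    ne : ∀ i → i < length rs → NonEmpty (runAt rs i)
    ne = RunChain-nonEmpty rs ch
    undecDec : ∀ i → Decreasing (undecAt rs i)
    undecDec i = undec-Decreasing (runAt rs i) (dec i)

  leftCompatibleAt : ∀ i → i < length rs → LeftCompatible (runAt rs i) (undecAt rs (suc i))
  leftCompatibleAt i p with i <? s
  ... | yes q = negative⇒leftCompatible (ne i p) (dec i) (atNegative (ad i) q)
  ... | no q = nonNegative⇒leftCompatible (atNonNegative (ad i) (≮⇒≥ q))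

  nextNonEmpty : ∀ i → i < length rs → i < s → Σ ℕ λ b → Σ (List ℕ) λ B → undecAt rs (suc i) ≡ b ∷ B
  nextNonEmpty i p q with undecAt rs (suc i) | atNegative (ad i) q
  ... | [] | c = ⊥-elim (negative⇒nextNonEmpty (ne i p) (dec i) c)
  ... | b ∷ B | _ = b , B , refl

  pivotShapeAt : ∀ i → suc i < length rs → HasPivotShape (runAt rs (suc i)) (undecAt rs (suc (suc i))) (undecAt rs (suc i))
  pivotShapeAt i p with <-cmp (suc i) s
  ... | tri> _ _ q = nonNegative-pivotShape _ _ (dec (suc i)) (ne (suc i) p) (undecDec (suc (suc i)))
    (atNonNegative (ad (suc i)) (<⇒≤ q)) (nonNegative-next-length≤2 (undecDec (suc i)) (atNonNegative (ad i) (≤-pred q)))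
  ... | tri≈ _ q _ = nonNegative-pivotShape _ _ (dec (suc i)) (ne (suc i) p) (undecDec (suc (suc i)))
    (atNonNegative (ad (suc i)) (≤-reflexive (sym q))) (m≤n⇒m≤1+n (zero-undec-length≤1 _ (dec (suc i)) (atZero (ad (suc i)) q)))
  ... | tri< q _ _ with nextNonEmpty (suc i) p q
  ...   | b , B , e with negative-pivotShape (runAt rs (suc i)) b B (dec (suc i)) (ne (suc i) p)
                           (subst Decreasing e (undecDec (suc (suc i)))) (subst (NegativeCondition _) e (atNegative (ad (suc i)) q))
  ...     | inj₁ noUndec = ⊥-elim (negative⇒nextNonEmpty (ne i (<-trans (n<1+n i) p)) (dec i)
                             (subst (NegativeCondition (runAt rs i)) noUndec (atNegative (ad i) (<-trans (n<1+n i) q))))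
  ...     | inj₂ (g , pv , sh) = g , subst (λ B → IsPivot (runAt rs (suc i)) B g) (sym e) pv , sh

  run0Shape : 0 < length rs → Run0Shape (runAt rs 0) (undecAt rs 1)
  run0Shape p with 0 <? s
  ... | no q = single pv (pivotShape-length≤1 {runAt rs 0} sh length≤1)
    where
    length≤1 = zero-undec-length≤1 _ (dec 0) (atZero (ad 0) (sym (n≤0⇒n≡0 (≮⇒≥ q))))
    shape = nonNegative-pivotShape _ _ (dec 0) (ne 0 p) (undecDec 1) (atNonNegative (ad 0) (≮⇒≥ q)) (m≤n⇒m≤1+n length≤1)
    pv = proj₁ (proj₂ shape)
    sh = proj₂ (proj₂ shape)
  run0Shape p | yes q with nextNonEmpty 0 p q
  ... | b , B , e with negative-pivotShape (runAt rs 0) b B (dec 0) (ne 0 p) (subst Decreasing e (undecDec 1))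
                         (subst (NegativeCondition _) e (atNegative (ad 0) q))
  ...   | inj₁ u = none (atNegative (ad 0) q) u
  ...   | inj₂ (g , pv , inj₁ u) = single (subst (λ B → IsPivot (runAt rs 0) B g) (sym e) pv) u
  ...   | inj₂ (g , pv , inj₂ (u , lt)) = double (atNegative (ad 0) q) (subst (λ B → IsPivot (runAt rs 0) B g) (sym e) pv) u lt

shifted-undec-unique : ∀ rs₁ rs₂ s₁ s₂ → map values rs₁ ≡ map values rs₂ → RunChain rs₁ →
  (∀ i → LocalConditions rs₁ s₁ i) → (∀ i → LocalConditions rs₂ s₂ i) →
  ∀ i → 0 < i → undecAt rs₁ i ≡ undecAt rs₂ i
shifted-undec-unique rs₁ rs₂ s₁ s₂ ev ch₁ ad₁ ad₂ =
  downward-induction (λ i → 0 < i → undecAt rs₁ i ≡ undecAt rs₂ i) (length rs₁)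
    (λ i p _ → undecAt-beyond {rs₁} {rs₂} eL i p) step
  where
  eL = map-≡⇒length≡ values rs₁ rs₂ ev
  module S₁ = Shifted rs₁ ch₁ s₁ ad₁
  module S₂ = Shifted rs₂ (RunChain-values rs₁ rs₂ ev ch₁) s₂ ad₂
  step : ∀ i → i < length rs₁ → (0 < suc i → undecAt rs₁ (suc i) ≡ undecAt rs₂ (suc i)) →
    0 < i → undecAt rs₁ i ≡ undecAt rs₂ i
  step (suc i) p ih _ with S₁.pivotShapeAt i p | S₂.pivotShapeAt i (subst (suc i <_) eL p)
  ... | g₁ , pv₁ , sh₁ | g₂ , pv₂ , sh₂ rewrite isPivot-unique′ (runAt-values rs₁ rs₂ ev (suc i)) (ih z<s) pv₁ pv₂ =
    pivotShape-unique {runAt rs₁ (suc i)} {runAt rs₂ (suc i)} sh₁ sh₂ (headValue-values (runAt-values rs₁ rs₂ ev (suc i)))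
      (runAt-values rs₁ rs₂ ev i) (S₁.leftCompatibleAt i i<l) (S₂.leftCompatibleAt i (subst (i <_) eL i<l))
    where
    i<l = <-trans (n<1+n i) p

-- The top letter of the run would score 1 against B in the first run and 0 against B in the second.
negative-none-vs-double : ∀ {X₁ X₂ B g} → values X₁ ≡ values X₂ → NonEmpty X₂ →
  NegativeCondition X₁ B → NegativeCondition X₂ B →
  undec X₁ ≡ [] → undec X₂ ≡ headValue X₂ ∷ g ∷ [] → g < headValue X₂ → ⊥
negative-none-vs-double {X₁} {X₂} {B} {g} ev ne c₁ c₂ e₁ e₂ gh =
  0≢1+n (trans (sym (m≡1∧m+n≡1⇒n≡0 top-pair score₂)) score₁)
  where
  h = headValue X₂
  h∈ = headValue-∈ X₂ ne
  score₁ : countGt h B ≡ 1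
  score₁ = subst (λ U → score U B h ≡ 1) e₁ (negative-at {X₁} {B} c₁ (subst (h ∈_) (sym ev) h∈))
  score₂ : countLt h (h ∷ g ∷ []) + countGt h B ≡ 1
  score₂ = subst (λ U → score U B h ≡ 1) e₂ (negative-at {X₂} {B} c₂ h∈)
  top-pair : countLt h (h ∷ g ∷ []) ≡ 1
  top-pair rewrite countLt-reject {h} {h} (g ∷ []) ≤-refl | countLt-accept {h} {g} [] gh = refl

run0Shape-unique : ∀ {X₁ X₂ B} T → values X₁ ≡ values X₂ → Run0Shape X₁ B → Run0Shape X₂ B →
  (length (undec X₁) + T) % 2 ≡ 1 → (length (undec X₂) + T) % 2 ≡ 1 → undec X₁ ≡ undec X₂
run0Shape-unique T ev (single pv₁ e₁) (single pv₂ e₂) _ _ =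
  trans e₁ (trans (cong (_∷ []) (isPivot-unique′ ev refl pv₁ pv₂)) (sym e₂))
run0Shape-unique T ev (none _ e₁) (none _ e₂) _ _ = trans e₁ (sym e₂)
run0Shape-unique {X₁} {X₂} T ev (double _ pv₁ e₁ _) (double _ pv₂ e₂ _) _ _ =
  trans e₁ (trans (cong₂ (λ h g → h ∷ g ∷ []) (headValue-values ev) (isPivot-unique′ ev refl pv₁ pv₂)) (sym e₂))
run0Shape-unique {X₂ = X₂} {B} T ev (none c₁ e₁) (double c₂ pv₂ e₂ gh) _ _ =
  ⊥-elim (negative-none-vs-double {B = B} ev (∈⇒NonEmpty X₂ (isPivot-∈ X₂ B pv₂)) c₁ c₂ e₁ e₂ gh)
run0Shape-unique {X₁} {B = B} T ev (double c₁ pv₁ e₁ gh) (none c₂ e₂) _ _ =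
  ⊥-elim (negative-none-vs-double {B = B} (sym ev) (∈⇒NonEmpty X₁ (isPivot-∈ X₁ B pv₁)) c₂ c₁ e₂ e₁ gh)
run0Shape-unique T ev (single _ e₁) (none _ e₂) o₁ o₂ rewrite e₁ | e₂ = ⊥-elim (parity-flip T o₂ o₁)
run0Shape-unique T ev (none _ e₁) (single _ e₂) o₁ o₂ rewrite e₁ | e₂ = ⊥-elim (parity-flip T o₁ o₂)
run0Shape-unique T ev (single _ e₁) (double _ _ e₂ _) o₁ o₂ rewrite e₁ | e₂ = ⊥-elim (parity-flip T o₂ o₁)
run0Shape-unique T ev (double _ _ e₁ _) (single _ e₂) o₁ o₂ rewrite e₁ | e₂ = ⊥-elim (parity-flip T o₁ o₂)

module Dyck (rs : List (List Letter)) (ch : RunChain rs) (dy : ∀ i → LocalConditions rs 0 i) where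
  private
    dec : ∀ i → Decreasing (values (runAt rs i))
    dec = RunChain-decreasing rs ch
    undecDec : ∀ i → Decreasing (undecAt rs i)
    undecDec i = undec-Decreasing (runAt rs i) (dec i)

  nonNegativeAt : ∀ i → NonNegativeCondition (runAt rs i) (undecAt rs (suc i))
  nonNegativeAt i = atNonNegative (dy i) z≤n

  undecAt0-length≤1 : length (undecAt rs 0) ≤ 1
  undecAt0-length≤1 = zero-undec-length≤1 (runAt rs 0) (dec 0) (atZero (dy 0) refl)

  undecAt-length≤2 : ∀ i → length (undecAt rs i) ≤ 2
  undecAt-length≤2 zero = m≤n⇒m≤1+n undecAt0-length≤1
  undecAt-length≤2 (suc i) = nonNegative-next-length≤2 (undecDec (suc i)) (nonNegativeAt i)

  pivotShapeAt : ∀ i → i < length rs → HasPivotShape (runAt rs i) (undecAt rs (suc i)) (undecAt rs i)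
  pivotShapeAt i p = nonNegative-pivotShape (runAt rs i) (undecAt rs (suc i)) (dec i) (RunChain-nonEmpty rs ch i p)
    (undecDec (suc i)) (nonNegativeAt i) (undecAt-length≤2 i)

  undecAt0 : (p : 0 < length rs) → undecAt rs 0 ≡ proj₁ (pivotShapeAt 0 p) ∷ []
  undecAt0 p = pivotShape-length≤1 {runAt rs 0} (proj₂ (proj₂ (pivotShapeAt 0 p))) undecAt0-length≤1

  admissibleAt : ∀ i → AdmissibleNext (runAt rs i) (undecAt rs (suc i))
  admissibleAt i = admissible (undecDec (suc i)) (undecAt-length≤2 (suc i)) aboveSecond disjoint
    where
    disjoint : ∀ x → x ∈ values (runAt rs i) → ∀ b → b ∈ undecAt rs (suc i) → x ≢ b
    disjoint x mx b mb refl = RunChain-disjoint rs ch i mx (undec-⊆ (runAt rs (suc i)) mb)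
    aboveSecond : ∀ {b₁ b₂} → undecAt rs (suc i) ≡ b₁ ∷ b₂ ∷ [] → ∀ x → x ∈ values (runAt rs i) → b₂ < x
    aboveSecond {b₁} {b₂} e x mx with <-cmp x b₂
    ... | tri> _ _ q = q
    ... | tri< q _ _ = ⊥-elim (proj₂ (nonNegative⇒leftCompatible (nonNegativeAt i)) e
                                 (Decreasing-below-head (subst Decreasing e (undecDec (suc i))) (here refl)) x mx q)
    ... | tri≈ _ q _ = ⊥-elim (disjoint x mx b₂ (subst (b₂ ∈_) (sym e) (there (here refl))) q)

  negativeAt : ∀ i → suc i < length rs → NegativeCondition (runAt rs i) (undecAt rs (suc i))
  negativeAt i p with pivotShapeAt i (<-trans (n<1+n i) p) | pivotShape-nonEmpty {runAt rs (suc i)} (proj₂ (proj₂ (pivotShapeAt (suc i) p)))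
  ... | g , pv , sh | b , B , e = subst (NegativeCondition (runAt rs i)) (sym e)
    (pivotShape⇒negative (runAt rs i) b B g (dec i) (RunChain-nonEmpty rs ch i (<-trans (n<1+n i) p))
      (subst (AdmissibleNext (runAt rs i)) e (admissibleAt i)) (subst (λ B → IsPivot (runAt rs i) B g) e pv) sh)

dyck-undec-unique : ∀ rs₁ rs₂ → map values rs₁ ≡ map values rs₂ → RunChain rs₁ → 0 < length rs₁ →
  (∀ i → LocalConditions rs₁ 0 i) → (∀ i → LocalConditions rs₂ 0 i) → ∀ i → undecAt rs₁ i ≡ undecAt rs₂ i
dyck-undec-unique rs₁ rs₂ ev ch₁ p dy₁ dy₂ zero =
  trans (D₁.undecAt0 p)
    (trans (cong (_∷ []) (isPivot-unique′ (runAt-values rs₁ rs₂ ev 0) next pv₁ pv₂)) (sym (D₂.undecAt0 p₂)))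
  where
  module D₁ = Dyck rs₁ ch₁ dy₁
  module D₂ = Dyck rs₂ (RunChain-values rs₁ rs₂ ev ch₁) dy₂
  p₂ = subst (0 <_) (map-≡⇒length≡ values rs₁ rs₂ ev) p
  next = shifted-undec-unique rs₁ rs₂ 0 0 ev ch₁ dy₁ dy₂ 1 z<s
  pv₁ = proj₁ (proj₂ (D₁.pivotShapeAt 0 p))
  pv₂ = proj₁ (proj₂ (D₂.pivotShapeAt 0 p₂))
dyck-undec-unique rs₁ rs₂ ev ch₁ p dy₁ dy₂ (suc i) = shifted-undec-unique rs₁ rs₂ 0 0 ev ch₁ dy₁ dy₂ (suc i) z<s

oddShifted-undec-unique : ∀ rs₁ rs₂ s₁ s₂ → map values rs₁ ≡ map values rs₂ → RunChain rs₁ → 0 < length rs₁ →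
  (∀ i → LocalConditions rs₁ s₁ i) → (∀ i → LocalConditions rs₂ s₂ i) →
  totalUndec rs₁ % 2 ≡ 1 → totalUndec rs₂ % 2 ≡ 1 → ∀ i → undecAt rs₁ i ≡ undecAt rs₂ i
oddShifted-undec-unique rs₁@(r₁ ∷ rest₁) rs₂@(r₂ ∷ rest₂) s₁ s₂ ev ch₁ p ad₁ ad₂ o₁ o₂ zero =
  run0Shape-unique (totalUndec rest₁) (∷-injectiveˡ ev) (S₁.run0Shape p)
    (subst (Run0Shape r₂) (sym (later 1 z<s)) (S₂.run0Shape z<s))
    o₁ (subst (λ T → (length (undec r₂) + T) % 2 ≡ 1) (sym sameTail) o₂)
  where
  later = shifted-undec-unique rs₁ rs₂ s₁ s₂ ev ch₁ ad₁ ad₂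
  module S₁ = Shifted rs₁ ch₁ s₁ ad₁
  module S₂ = Shifted rs₂ (RunChain-values rs₁ rs₂ ev ch₁) s₂ ad₂
  sameTail : totalUndec rest₁ ≡ totalUndec rest₂
  sameTail = totalUndec-cong rest₁ rest₂ (suc-injective (map-≡⇒length≡ values rs₁ rs₂ ev)) (λ i → later (suc i) z<s)
oddShifted-undec-unique rs₁ rs₂ s₁ s₂ ev ch₁ p ad₁ ad₂ o₁ o₂ (suc i) =
  shifted-undec-unique rs₁ rs₂ s₁ s₂ ev ch₁ ad₁ ad₂ (suc i) z<s

-- Existence

_∈ᵇ_ : ℕ → List ℕ → Bool
v ∈ᵇ [] = false
v ∈ᵇ (u ∷ U) = (v ≡ᵇ u) ∨ (v ∈ᵇ U)

∉⇒∈ᵇ-false : ∀ v U → v ∉ U → (v ∈ᵇ U) ≡ false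
∉⇒∈ᵇ-false v [] _ = refl
∉⇒∈ᵇ-false v (u ∷ U) n rewrite ≢⇒≡ᵇ-false {v} {u} (n ∘′ here) = ∉⇒∈ᵇ-false v U (n ∘′ there)

undecorateOnly : List ℕ → List Letter → List Letter
undecorateOnly U = map λ l → proj₁ l , not (proj₁ l ∈ᵇ U)

values-undecorateOnly : ∀ U r → values (undecorateOnly U r) ≡ values r
values-undecorateOnly U [] = refl
values-undecorateOnly U (l ∷ r) = cong (proj₁ l ∷_) (values-undecorateOnly U r)

headValue-undecorateOnly : ∀ U r → headValue (undecorateOnly U r) ≡ headValue r
headValue-undecorateOnly U [] = refl
headValue-undecorateOnly U (l ∷ r) = refl

undecorateOnly-cong : ∀ {U₁ U₂} r → (∀ v → v ∈ values r → (v ∈ᵇ U₁) ≡ (v ∈ᵇ U₂)) →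
  undecorateOnly U₁ r ≡ undecorateOnly U₂ r
undecorateOnly-cong [] f = refl
undecorateOnly-cong {U₁} {U₂} (l ∷ r) f =
  cong₂ _∷_ (cong (λ b → proj₁ l , not b) (f (proj₁ l) (here refl))) (undecorateOnly-cong {U₁} {U₂} r (λ v → f v ∘′ there))

undec-undecorateOnly-disjoint : ∀ U r → (∀ v → v ∈ values r → v ∉ U) → undec (undecorateOnly U r) ≡ []
undec-undecorateOnly-disjoint U [] f = refl
undec-undecorateOnly-disjoint U (l ∷ r) f rewrite ∉⇒∈ᵇ-false (proj₁ l) U (f (proj₁ l) (here refl)) =
  undec-undecorateOnly-disjoint U r (λ v → f v ∘′ there)

undec-undecorateOnly-single : ∀ r {g} → Decreasing (values r) → g ∈ values r → undec (undecorateOnly (g ∷ []) r) ≡ g ∷ []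
undec-undecorateOnly-single ((x , _) ∷ r) (a ∷ s) (here refl) rewrite ≡ᵇ-refl x =
  cong (x ∷_) (undec-undecorateOnly-disjoint (x ∷ []) r λ v m → ∉-singleton (<⇒≢ (All.lookup a m)))
undec-undecorateOnly-single ((x , _) ∷ r) {g} (a ∷ s) (there m) rewrite ≢⇒≡ᵇ-false {x} {g} (>⇒≢ (All.lookup a m)) =
  undec-undecorateOnly-single r s m

undec-undecorateOnly-pair : ∀ r {g} → Decreasing (values r) → g ∈ values r → g < headValue r →
  undec (undecorateOnly (headValue r ∷ g ∷ []) r) ≡ headValue r ∷ g ∷ []
undec-undecorateOnly-pair ((x , _) ∷ r) (a ∷ s) (here refl) p = ⊥-elim (<-irrefl refl p)
undec-undecorateOnly-pair ((x , _) ∷ r) {g} (a ∷ s) (there m) p rewrite ≡ᵇ-refl x =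
  cong (x ∷_) (trans (cong undec (undecorateOnly-cong {x ∷ g ∷ []} {g ∷ []} r
                        λ v mv → cong (_∨ ((v ≡ᵇ g) ∨ false)) (≢⇒≡ᵇ-false (<⇒≢ (All.lookup a mv)))))
                     (undec-undecorateOnly-single r s m))

firstBelow : ℕ → List ℕ → ℕ
firstBelow b [] = 0
firstBelow b (x ∷ V) = if x <ᵇ b then x else firstBelow b V

pivotOf : List ℕ → List ℕ → ℕ
pivotOf V [] = lastValue V
pivotOf V (b ∷ _) = firstBelow b V

HasLetterBelow : List Letter → List ℕ → Set
HasLetterBelow r B = ∀ {b B′} → B ≡ b ∷ B′ → Σ ℕ λ x → x ∈ values r × x < b

firstBelow-spec : ∀ b V {x} → Decreasing V → x ∈ V → x < b →
  firstBelow b V ∈ V × firstBelow b V < b × (∀ y → y ∈ V → y < b → y ≤ firstBelow b V)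
firstBelow-spec b (v ∷ V) s m p with v <ᵇ b in e
... | true = here refl , <ᵇ-true⁻ e , λ y my _ → Decreasing-≤head s my
firstBelow-spec b (v ∷ V) s (here refl) p | false = ⊥-elim (<⇒≱ p (<ᵇ-false⁻ e))
firstBelow-spec b (v ∷ V) (_ ∷ s) (there m) p | false with firstBelow-spec b V s m p
... | m₁ , p₁ , f₁ = there m₁ , p₁ , λ { y (here refl) q → ⊥-elim (<⇒≱ q (<ᵇ-false⁻ e)) ; y (there my) q → f₁ y my q }

pivotOf-isPivot : ∀ r B → NonEmpty r → Decreasing (values r) → HasLetterBelow r B → IsPivot r B (pivotOf (values r) B)
pivotOf-isPivot r [] ne s _ = lastValue-∈values r ne , λ x → lastValue-≤ (values r) s
pivotOf-isPivot r (b ∷ B) ne s below with below refl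
... | x , mx , p = firstBelow-spec b (values r) s mx p

-- `previous` is the last value of the run to the left, if any; the pivot needs its neighbour at the top of
-- the run exactly when no letter of the left run lies below it.
needsPair : Maybe ℕ → ℕ → Bool
needsPair nothing g = false
needsPair (just k) g = g <ᵇ k

dyckUndec : Maybe ℕ → List Letter → ℕ → List ℕ
dyckUndec previous r g = if needsPair previous g then headValue r ∷ g ∷ [] else g ∷ []

dyckRuns : Maybe ℕ → List (List Letter) → List (List Letter)
dyckRuns previous [] = []
dyckRuns previous (r ∷ rest) = undecorateOnly (dyckUndec previous r (pivotOf (values r) (undecAt later 0))) r ∷ later
  where later = dyckRuns (just (lastValue (values r))) rest

dyckUndec-cases : ∀ previous r g → (needsPair previous g ≡ true × dyckUndec previous r g ≡ headValue r ∷ g ∷ [])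
                                   ⊎ (needsPair previous g ≡ false × dyckUndec previous r g ≡ g ∷ [])
dyckUndec-cases previous r g with needsPair previous g
... | true = inj₁ (refl , refl)
... | false = inj₂ (refl , refl)

admissible-values : ∀ {X Y B} → values X ≡ values Y → AdmissibleNext X B → AdmissibleNext Y B
admissible-values e (admissible sB lB ab dj) =
  admissible sB lB (λ eB x mx → ab eB x (subst (x ∈_) (sym e) mx)) (λ x mx → dj x (subst (x ∈_) (sym e) mx))

needsPair⇒<headValue : ∀ previous g r → (∀ {k} → previous ≡ just k → k < headValue r) →
  needsPair previous g ≡ true → g < headValue r
needsPair⇒<headValue (just k) g r below e = <-trans (<ᵇ-true⁻ e) (below refl)

dyckStep : ∀ previous r B → NonEmpty r → Decreasing (values r) → AdmissibleNext r B → HasLetterBelow r B →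
  (needsPair previous (pivotOf (values r) B) ≡ true → pivotOf (values r) B < headValue r) →
  NonNegativeCondition (undecorateOnly (dyckUndec previous r (pivotOf (values r) B)) r) B ×
  undec (undecorateOnly (dyckUndec previous r (pivotOf (values r) B)) r) ≡ dyckUndec previous r (pivotOf (values r) B)
dyckStep previous r B ne s adm below pair = pivotShape⇒nonNegative X B g (subst Decreasing (sym ev) s) (NonEmpty-values (sym ev) ne)
  (admissible-values (sym ev) adm) (isPivot-values B (sym ev) pv) shape , undecX
  where
  g = pivotOf (values r) B
  pv = pivotOf-isPivot r B ne s below
  U = dyckUndec previous r g
  X = undecorateOnly U r
  ev = values-undecorateOnly U r
  eh = headValue-undecorateOnly U r
  undecX : undec X ≡ U
  undecX with dyckUndec-cases previous r g
  ... | inj₁ (p , e) = trans (cong (λ U → undec (undecorateOnly U r)) e)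
                         (trans (undec-undecorateOnly-pair r s (isPivot-∈ r B pv) (pair p)) (sym e))
  ... | inj₂ (p , e) = trans (cong (λ U → undec (undecorateOnly U r)) e)
                         (trans (undec-undecorateOnly-single r s (isPivot-∈ r B pv)) (sym e))
  shape : PivotShape X g (undec X)
  shape with dyckUndec-cases previous r g
  ... | inj₁ (p , e) = inj₂ (trans undecX (trans e (cong (_∷ g ∷ []) (sym eh))) , subst (g <_) (sym eh) (pair p))
  ... | inj₂ (p , e) = inj₁ (trans undecX e)

record DyckRunsSpec (previous : Maybe ℕ) (r : List Letter) (rest : List (List Letter)) : Set where
  field
    sameValues : map values (dyckRuns previous (r ∷ rest)) ≡ map values (r ∷ rest)
    nonNegative : ∀ i → NonNegativeCondition (runAt (dyckRuns previous (r ∷ rest)) i) (undecAt (dyckRuns previous (r ∷ rest)) (suc i))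
    pivot : ℕ
    pivot∈ : pivot ∈ values r
    firstUndec : undecAt (dyckRuns previous (r ∷ rest)) 0 ≡ dyckUndec previous r pivot
    pairBelowHead : needsPair previous pivot ≡ true → pivot < headValue r

module _ (r r′ : List Letter) (ne : NonEmpty r) (s : Decreasing (values r)) (ne′ : NonEmpty r′)
         (ascent : lastValue (values r) < headValue r′) (disjoint : ∀ {x} → x ∈ values r → x ∉ values r′)
         {g′ : ℕ} (g′∈ : g′ ∈ values r′) where
  pairNext-admissible : g′ < headValue r′ → g′ < lastValue (values r) →
    AdmissibleNext r (headValue r′ ∷ g′ ∷ []) × HasLetterBelow r (headValue r′ ∷ g′ ∷ [])
  pairNext-admissible g′<h g′<last =
    admissible ((g′<h ∷ []) ∷ [] ∷ []) (s≤s (s≤s z≤n))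
      (λ { refl x mx → <-≤-trans g′<last (lastValue-≤ (values r) s mx) })
      (λ { x mx b (here refl) e → disjoint mx (subst (_∈ values r′) (sym e) (headValue-∈ r′ ne′))
         ; x mx b (there (here refl)) e → disjoint mx (subst (_∈ values r′) (sym e) g′∈) }) ,
    λ { refl → lastValue (values r) , lastValue-∈values r ne , ascent }

  singleNext-admissible : lastValue (values r) ≤ g′ → AdmissibleNext r (g′ ∷ []) × HasLetterBelow r (g′ ∷ [])
  singleNext-admissible last≤g′ =
    admissible ([] ∷ []) (s≤s z≤n) (λ ()) (λ { x mx b (here refl) e → disjoint mx (subst (_∈ values r′) (sym e) g′∈) }) ,
    λ { refl → lastValue (values r) , lastValue-∈values r ne ,
               ≤∧≢⇒< last≤g′ (λ e → disjoint (lastValue-∈values r ne) (subst (_∈ values r′) (sym e) g′∈)) }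

dyckRuns-spec : ∀ previous r rest → RunChain (r ∷ rest) → (∀ {k} → previous ≡ just k → k < headValue r) →
  DyckRunsSpec previous r rest
dyckRuns-spec previous r [] (ne , s) below = record
  { sameValues = cong (_∷ []) (values-undecorateOnly (dyckUndec previous r (lastValue (values r))) r)
  ; nonNegative = λ { zero → proj₁ step ; (suc i) → [] , [] }
  ; pivot = lastValue (values r)
  ; pivot∈ = lastValue-∈values r ne
  ; firstUndec = proj₂ step
  ; pairBelowHead = pair
  }
  where
  pair = needsPair⇒<headValue previous (lastValue (values r)) r below
  step = dyckStep previous r [] ne s (admissible [] z≤n (λ ()) (λ _ _ _ ())) (λ ()) pair
dyckRuns-spec previous r (r′ ∷ rest) (ne , s , ascent , disjoint , ch) below = record
  { sameValues = cong₂ _∷_ (values-undecorateOnly (dyckUndec previous r g) r) sameValues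
  ; nonNegative = λ { zero → proj₁ step ; (suc i) → nonNegative i }
  ; pivot = g
  ; pivot∈ = isPivot-∈ r B (pivotOf-isPivot r B ne s (proj₂ next))
  ; firstUndec = proj₂ step
  ; pairBelowHead = pair
  }
  where
  spec′ = dyckRuns-spec (just (lastValue (values r))) r′ rest ch (λ { refl → ascent })
  open DyckRunsSpec spec′
  B = undecAt (dyckRuns (just (lastValue (values r))) (r′ ∷ rest)) 0
  g = pivotOf (values r) B
  next : AdmissibleNext r B × HasLetterBelow r B
  next with dyckUndec-cases (just (lastValue (values r))) r′ pivot
  ... | inj₁ (p , e) = subst (λ B → AdmissibleNext r B × HasLetterBelow r B) (sym (trans firstUndec e))
    (pairNext-admissible r r′ ne s (RunChain-nonEmpty (r′ ∷ rest) ch 0 z<s) ascent disjoint pivot∈ (pairBelowHead p) (<ᵇ-true⁻ p))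
  ... | inj₂ (p , e) = subst (λ B → AdmissibleNext r B × HasLetterBelow r B) (sym (trans firstUndec e))
    (singleNext-admissible r r′ ne s (RunChain-nonEmpty (r′ ∷ rest) ch 0 z<s) ascent disjoint pivot∈ (<ᵇ-false⁻ p))
  pair = needsPair⇒<headValue previous g r below
  step = dyckStep previous r B ne s (proj₁ next) (proj₂ next) pair

dyck-exists : ∀ rs → RunChain rs → 0 < length rs →
  Σ (List (List Letter)) λ rs′ → map values rs′ ≡ map values rs × (∀ i → LocalConditions rs′ 0 i)
dyck-exists (r ∷ rest) ch _ =
  dyckRuns nothing (r ∷ rest) , sameValues ,
  λ i → local (λ ()) (λ { refl → single⇒zeroCondition _ firstUndec }) (λ _ → nonNegative i)
  where open DyckRunsSpec (dyckRuns-spec nothing r rest ch (λ ()))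

flipped-run : ∀ r b B {g} → Decreasing (values r) → NonEmpty r → AdmissibleNext r (b ∷ B) → IsPivot r (b ∷ B) g →
  Σ (List Letter) λ X → values X ≡ values r × NegativeCondition X (b ∷ B) × ((length (undec X) ≡ 0) ⊎ (length (undec X) ≡ 2))
flipped-run r b B {g} s ne adm pv with headValue r <? b
... | yes h<b = X , ev , noUndec⇒negative X b B noUndec (admissible-values (sym ev) adm)
                  (λ x mx → ≤-<-trans (headValue-≥ r s (subst (x ∈_) ev mx)) h<b) , inj₁ (cong length noUndec)
  where
  X = undecorateOnly [] r
  ev = values-undecorateOnly [] r
  noUndec = undec-undecorateOnly-disjoint [] r (λ _ _ ())
... | no h≮b = X , ev , pivotShape⇒negative X b B g (subst Decreasing (sym ev) s) (NonEmpty-values (sym ev) ne)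
                          (admissible-values (sym ev) adm) (isPivot-values (b ∷ B) (sym ev) pv) shape , inj₂ (cong length pair)
  where
  U = headValue r ∷ g ∷ []
  X = undecorateOnly U r
  ev = values-undecorateOnly U r
  eh = headValue-undecorateOnly U r
  b<h : b < headValue r
  b<h = ≤∧≢⇒< (≮⇒≥ h≮b) λ e → AdmissibleNext.disjoint adm (headValue r) (headValue-∈ r ne) b (here refl) (sym e)
  g<h : g < headValue r
  g<h = <-trans (proj₁ (proj₂ pv)) b<h
  pair : undec X ≡ U
  pair = undec-undecorateOnly-pair r s (isPivot-∈ r (b ∷ B) pv) g<h
  shape : PivotShape X g (undec X)
  shape = inj₂ (trans pair (cong (_∷ g ∷ []) (sym eh)) , subst (g <_) (sym eh) g<h)

flip-run0 : ∀ r rest → RunChain (r ∷ rest) → (∀ i → LocalConditions (r ∷ rest) 0 i) →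
  ∀ j → j < length rest → length (undecAt rest j) ≡ 1 →
  Σ (List Letter) λ X → values X ≡ values r × ((length (undec X) ≡ 0) ⊎ (length (undec X) ≡ 2)) ×
    (∀ i → LocalConditions (X ∷ rest) (suc j) i)
flip-run0 r rest ch dy j j<l oneUndec
  with pivotShape-nonEmpty {runAt rest 0} (proj₂ (proj₂ (Dyck.pivotShapeAt (r ∷ rest) ch dy 1 (s≤s (≤-<-trans z≤n j<l)))))
... | b , B , eb
  with flipped-run r b B (RunChain-decreasing (r ∷ rest) ch 0) (RunChain-nonEmpty (r ∷ rest) ch 0 z<s)
         (subst (AdmissibleNext r) eb (admissibleAt 0)) (subst (λ B → IsPivot r B g₀) eb pv₀)
  where
  open Dyck (r ∷ rest) ch dy
  g₀ = proj₁ (pivotShapeAt 0 z<s)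
  pv₀ = proj₁ (proj₂ (pivotShapeAt 0 z<s))
... | X , ev , neg , len = X , ev , len , conditions
  where
  open Dyck (r ∷ rest) ch dy
  conditions : ∀ i → LocalConditions (X ∷ rest) (suc j) i
  conditions zero = local (λ _ → subst (NegativeCondition X) (sym eb) neg) (λ ()) (λ ())
  conditions (suc i) = local (λ p → negativeAt (suc i) (s≤s (≤-<-trans (≤-pred p) j<l))) zeroRun (λ _ → nonNegativeAt (suc i))
    where
    zeroRun : suc i ≡ suc j → ZeroCondition (runAt rest i)
    zeroRun refl = single⇒zeroCondition (runAt rest i)
      (pivotShape-length≤1 {runAt rest i} (proj₂ (proj₂ (pivotShapeAt (suc i) (s≤s j<l)))) (≤-reflexive oneUndec))

someSingle-or-allPairs : ∀ ts → (∀ j → j < length ts → (length (undecAt ts j) ≡ 1) ⊎ (length (undecAt ts j) ≡ 2)) →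
  (Σ ℕ λ j → j < length ts × length (undecAt ts j) ≡ 1) ⊎ (totalUndec ts ≡ length ts + length ts)
someSingle-or-allPairs [] f = inj₂ refl
someSingle-or-allPairs (t ∷ ts) f with f 0 z<s
... | inj₁ e = inj₁ (0 , z<s , e)
... | inj₂ e with someSingle-or-allPairs ts (λ j p → f (suc j) (s≤s p))
...   | inj₁ (j , p , e′) = inj₁ (suc j , s≤s p , e′)
...   | inj₂ e′ rewrite e | e′ = inj₂ (cong suc (sym (+-suc (length ts) (length ts))))

oddShifted-exists : ∀ rs → RunChain rs → 0 < length rs → (∀ i → LocalConditions rs 0 i) →
  Σ (List (List Letter)) λ rs′ → map values rs′ ≡ map values rs ×
    Σ ℕ λ s → s < length rs′ × (∀ i → LocalConditions rs′ s i) × totalUndec rs′ % 2 ≡ 1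
oddShifted-exists (r ∷ rest) ch _ dy with parity (totalUndec rest)
... | inj₂ odd = r ∷ rest , refl , 0 , z<s , dy , subst (λ U → (length U + totalUndec rest) % 2 ≡ 1) (sym (undecAt0 z<s)) odd
  where open Dyck (r ∷ rest) ch dy
... | inj₁ odd with someSingle-or-allPairs rest lengths
  where
  open Dyck (r ∷ rest) ch dy
  lengths : ∀ j → j < length rest → (length (undecAt rest j) ≡ 1) ⊎ (length (undecAt rest j) ≡ 2)
  lengths j p with pivotShapeAt (suc j) (s≤s p)
  ... | _ , _ , inj₁ e = inj₁ (cong length e)
  ... | _ , _ , inj₂ (e , _) = inj₂ (cong length e)
...   | inj₂ allPairs = ⊥-elim (double-even (length rest) (subst (λ n → n % 2 ≡ 1) allPairs odd))
...   | inj₁ (j , j<l , oneUndec) with flip-run0 r rest ch dy j j<l oneUndec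
...     | X , ev , len , conditions = X ∷ rest , cong (_∷ map values rest) ev , suc j , s≤s j<l , conditions , oddX len
  where
  oddX : (length (undec X) ≡ 0) ⊎ (length (undec X) ≡ 2) → totalUndec (X ∷ rest) % 2 ≡ 1
  oddX (inj₁ e) rewrite e = odd
  oddX (inj₂ e) rewrite e = odd

-- Decorations of a permutation

letters-ext : ∀ (w₁ w₂ : List Letter) → values w₁ ≡ values w₂ → map proj₂ w₁ ≡ map proj₂ w₂ → w₁ ≡ w₂
letters-ext [] [] _ _ = refl
letters-ext ((a , b) ∷ w₁) ((c , d) ∷ w₂) e₁ e₂ =
  cong₂ _∷_ (cong₂ _,_ (∷-injectiveˡ e₁) (∷-injectiveˡ e₂)) (letters-ext w₁ w₂ (∷-injectiveʳ e₁) (∷-injectiveʳ e₂))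

++-injective : ∀ {A : Set} (x y u v : List A) → length x ≡ length y → x ++ u ≡ y ++ v → x ≡ y × u ≡ v
++-injective [] [] u v _ e = refl , e
++-injective (a ∷ x) (b ∷ y) u v l e with ++-injective x y u v (suc-injective l) (∷-injectiveʳ e)
... | e₁ , e₂ = cong₂ _∷_ (∷-injectiveˡ e) e₁ , e₂

concat-injective : ∀ (a b : List (List Letter)) → map values a ≡ map values b → concat a ≡ concat b → a ≡ b
concat-injective [] [] _ _ = refl
concat-injective (x ∷ a) (y ∷ b) ev ec with ++-injective x y (concat a) (concat b) (map-≡⇒length≡ proj₁ x y (∷-injectiveˡ ev)) ec
... | e₁ , e₂ = cong₂ _∷_ e₁ (concat-injective a b (∷-injectiveʳ ev) e₂)

values-concat : ∀ rs → values (concat rs) ≡ concat (map values rs)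
values-concat rs = sym (concat-map rs)

runs-concat : ∀ w rs → map values rs ≡ map values (runs w) → runs (concat rs) ≡ rs
runs-concat w rs ev = concat-injective (runs (concat rs)) rs (trans (runs-values (concat rs) w sameValues) (sym ev)) (concat-runs (concat rs))
  where
  sameValues : values (concat rs) ≡ values w
  sameValues = trans (values-concat rs) (trans (cong concat ev) (trans (sym (values-concat (runs w))) (cong values (concat-runs w))))

undec-++ : ∀ a b → undec (a ++ b) ≡ undec a ++ undec b
undec-++ a b = trans (cong values (filter-++ (λ l → T? (not (proj₂ l))) a b))
  (map-++ proj₁ (filterᵇ (λ l → not (proj₂ l)) a) (filterᵇ (λ l → not (proj₂ l)) b))

totalUndec-concat : ∀ rs → length (undec (concat rs)) ≡ totalUndec rs
totalUndec-concat [] = refl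
totalUndec-concat (r ∷ rs) = trans (cong length (undec-++ r (concat rs)))
  (trans (length-++ (undec r)) (cong (length (undec r) +_) (totalUndec-concat rs)))

length-undec : ∀ w → length (filterᵇ not (map proj₂ w)) ≡ length (undec w)
length-undec [] = refl
length-undec ((v , true) ∷ w) = length-undec w
length-undec ((v , false) ∷ w) = cong suc (length-undec w)

runs-nonEmpty : ∀ x xs → 0 < length (runs (x ∷ xs))
runs-nonEmpty x xs with runs xs
... | [] = z<s
... | [] ∷ rs = z<s
... | (y ∷ r) ∷ rs with proj₁ y <ᵇ proj₁ x
... | true = z<s
... | false = z<s

values-tabulate : ∀ {n} (f : Fin n → ℕ) (h : Fin n → Bool) → values (toList (Vec.tabulate (λ i → f i , h i))) ≡ List.tabulate f
values-tabulate {zero} f h = refl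
values-tabulate {suc n} f h = cong (f Fin.zero ∷_) (values-tabulate (f ∘′ Fin.suc) (h ∘′ Fin.suc))

decorations-tabulate : ∀ {n} (f : Fin n → ℕ) (d : Vec Bool n) →
  map proj₂ (toList (Vec.tabulate (λ i → f i , lookup d i))) ≡ toList d
decorations-tabulate f Vec.[] = refl
decorations-tabulate f (b Vec.∷ d) = cong (b ∷_) (decorations-tabulate (f ∘′ Fin.suc) d)

module Decorations {n} (σ : Permutation′ n) where
  letter : Fin n → ℕ
  letter i = toℕ (σ ⟨$⟩ʳ i)

  runsOf : Vec Bool n → List (List Letter)
  runsOf d = runs (decWord σ d)

  values-decWord : ∀ d → values (decWord σ d) ≡ List.tabulate letter
  values-decWord d = values-tabulate letter (lookup d)

  decorations-decWord : ∀ d → map proj₂ (decWord σ d) ≡ toList d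
  decorations-decWord d = decorations-tabulate letter d

  runsOf-values : ∀ d₁ d₂ → map values (runsOf d₁) ≡ map values (runsOf d₂)
  runsOf-values d₁ d₂ = runs-values (decWord σ d₁) (decWord σ d₂) (trans (values-decWord d₁) (sym (values-decWord d₂)))

  runsOf-RunChain : ∀ d → RunChain (runsOf d)
  runsOf-RunChain d = runs-RunChain (decWord σ d) (subst Unique (sym (values-decWord d)) (tabulate⁺ letter-injective))
    where
    letter-injective : ∀ {i j} → letter i ≡ letter j → i ≡ j
    letter-injective e = trans (sym (inverseˡ σ)) (trans (cong (σ ⟨$⟩ˡ_) (toℕ-injective e)) (inverseˡ σ))

  runsOf-realise : ∀ d₀ rs → map values rs ≡ map values (runsOf d₀) → Σ (Vec Bool n) λ d → runsOf d ≡ rs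
  runsOf-realise d₀ rs ev = d , trans (cong runs word) (runs-concat (decWord σ d₀) rs ev)
    where
    sameValues : values (concat rs) ≡ List.tabulate letter
    sameValues = trans (values-concat rs) (trans (cong concat ev)
      (trans (sym (values-concat (runsOf d₀))) (trans (cong values (concat-runs (decWord σ d₀))) (values-decWord d₀))))
    size : length (map proj₂ (concat rs)) ≡ n
    size = trans (length-map proj₂ (concat rs)) (trans (sym (length-map proj₁ (concat rs)))
      (trans (cong length sameValues) (length-tabulate letter)))
    d = Vec.cast size (Vec.fromList (map proj₂ (concat rs)))
    word : decWord σ d ≡ concat rs
    word = letters-ext (decWord σ d) (concat rs) (trans (values-decWord d) (sym sameValues))
      (trans (decorations-decWord d) (trans (toList-cast size _) (toList∘fromList _)))

  runsOf-injective : ∀ d₁ d₂ → (∀ i → undecAt (runsOf d₁) i ≡ undecAt (runsOf d₂) i) → d₁ ≡ d₂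
  runsOf-injective d₁ d₂ h = trans (sym (cast-is-id refl d₁)) (toList-injective refl d₁ d₂
    (trans (sym (decorations-decWord d₁)) (trans (cong (map proj₂) sameWord) (decorations-decWord d₂))))
    where
    ev = runsOf-values d₁ d₂
    sameRun : ∀ i → runAt (runsOf d₁) i ≡ runAt (runsOf d₂) i
    sameRun i = run-determined-by-undec _ _ (runAt-values (runsOf d₁) (runsOf d₂) ev i)
                  (RunChain-decreasing _ (runsOf-RunChain d₁) i) (h i)
    sameWord : decWord σ d₁ ≡ decWord σ d₂
    sameWord = trans (sym (concat-runs (decWord σ d₁)))
      (trans (cong concat (runAt-injective (runsOf d₁) (runsOf d₂) (map-≡⇒length≡ values (runsOf d₁) (runsOf d₂) ev) sameRun))
             (concat-runs (decWord σ d₂)))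

  numUndecorated≡totalUndec : ∀ d → numUndecorated d ≡ totalUndec (runsOf d)
  numUndecorated≡totalUndec d = trans (cong (λ bs → length (filterᵇ not bs)) (sym (decorations-decWord d)))
    (trans (length-undec (decWord σ d)) (trans (cong (length ∘′ undec) (sym (concat-runs (decWord σ d)))) (totalUndec-concat (runsOf d))))

  allScheduleOne⇔local : ∀ d s → s < numRuns σ d → AllScheduleOne σ d s ⇔ (∀ i → LocalConditions (runsOf d) s i)
  allScheduleOne⇔local d s s<l = mk⇔
    (λ a → scheduleOne⇒local (runsOf d) s s<l (schedules⇒runwise (runsOf d) s a))
    (λ c → runwise⇒schedules (runsOf d) s (local⇒scheduleOne (runsOf d) s s<l c))

  length-decWord : ∀ d → length (decWord σ d) ≡ n
  length-decWord d = trans (sym (length-map proj₁ (decWord σ d))) (trans (cong length (values-decWord d)) (length-tabulate letter))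

  runsOf-nonEmpty : 1 ≤ n → ∀ d → 0 < numRuns σ d
  runsOf-nonEmpty p d with decWord σ d | length-decWord d
  ... | x ∷ xs | _ = runs-nonEmpty x xs
  ... | [] | e = ⊥-elim (<⇒≢ p e)

  blank : Vec Bool n
  blank = Vec.replicate n false

  dyck-∃! : 1 ≤ n → ∃! _≡_ (IsDyckADR σ)
  dyck-∃! p with dyck-exists (runsOf blank) (runsOf-RunChain blank) (runsOf-nonEmpty p blank)
  ... | rs , ev , dy with runsOf-realise blank rs ev
  ... | d , refl = d , Equivalence.from (allScheduleOne⇔local d 0 (runsOf-nonEmpty p d)) dy , λ {d′} a →
    runsOf-injective d d′ (dyck-undec-unique (runsOf d) (runsOf d′) (runsOf-values d d′) (runsOf-RunChain d) (runsOf-nonEmpty p d)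
      dy (Equivalence.to (allScheduleOne⇔local d′ 0 (runsOf-nonEmpty p d′)) a))

  oddADR-∃! : 1 ≤ n → ∃! _≡_ (λ d → IsADR σ d × Odd (numUndecorated d))
  oddADR-∃! p with dyck-∃! p
  ... | d₀ , dyck , _ with oddShifted-exists (runsOf d₀) (runsOf-RunChain d₀) (runsOf-nonEmpty p d₀)
                             (Equivalence.to (allScheduleOne⇔local d₀ 0 (runsOf-nonEmpty p d₀)) dyck)
  ... | rs , ev , s , s<l , ad , odd with runsOf-realise d₀ rs ev
  ... | d , refl = d , ((s , s<l , Equivalence.from (allScheduleOne⇔local d s s<l) ad) , subst Odd (sym (numUndecorated≡totalUndec d)) odd) ,
    λ { {d′} ((s′ , s′<l , a′) , odd′) → runsOf-injective d d′
          (oddShifted-undec-unique (runsOf d) (runsOf d′) s s′ (runsOf-values d d′) (runsOf-RunChain d) (runsOf-nonEmpty p d)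
            ad (Equivalence.to (allScheduleOne⇔local d′ s′ s′<l) a′) odd (subst Odd (numUndecorated≡totalUndec d′) odd′)) }

mainTheorem5 : (n : ℕ) → 1 ≤ n → (σ : Permutation′ n) →
    ∃! _≡_ (λ (d : Vec Bool n) → IsDyckADR σ d)
    × ∃! _≡_ (λ (d : Vec Bool n) → IsADR σ d × Odd (numUndecorated d))
mainTheorem5 n p σ = dyck-∃! p , oddADR-∃! p
  where open Decorations σ
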